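{- There is an algorithm to decide whether an affine counter system is a strongly monotonic WSTS.
   Context: A relational counter system with $n$ counters is $\mathcal C=(Q,R,\rightarrow)$ with $Q$ a finite set of control states, $R$ a finite set of Presburger-definable relations on $\mathbb N^n$ (given by Presburger formulas), and $\rightarrow\subseteq Q\times R\times Q$. An affine counter system (ACS) is one where each relation is the graph of a partial function $f$ with Presburger-definable domain and $f(x)=Ax+b$ on $\mathrm{dom} f$, for some $A\in\mathbb N^{n\times n}$ (non-negative coefficients) and $b\in\mathbb Z^n$. It is viewed as a transition system on $Q\times\mathbb N^n$ with $(q,x)\to(q',f(x))$ whenever $(q,f,q')\in\rightarrow$ and $x\in\mathrm{dom}f$, ordered by $(q,x)\leq(q',x')$ iff $q=q'$ and $x\leq x'$ componentwise. A WSTS is an ordered transition system whose order is a well partial order and which is monotonic (whenever $s\to s'$ and $s_1\geq s$ there is $s_1'$ with $s_1\to^*s_1'$ and $s_1'\geq s'$); it is strongly monotonic iff whenever $s\to s'$ and $s_1\geq s$ there is $s_1'$ with $s_1\to s_1'$ and $s_1'\geq s'$. -}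

module Defs where

open import Data.Nat using (ℕ; _<_) renaming (_+_ to _+ℕ_; _≤_ to _≤ℕ_)
open import Data.Integer using (ℤ; +_) renaming (_+_ to _+ℤ_; _*_ to _*ℤ_)
open import Data.Fin using (Fin)
open import Data.Vec using (Vec; _∷_; lookup; foldr; zipWith; replicate; map)
open import Data.Vec.Relation.Binary.Pointwise.Inductive using (Pointwise)
open import Data.List using (List)
open import Data.List.Membership.Propositional using (_∈_)
open import Data.Product using (Σ; ∃; _×_; _,_)
open import Data.Sum using (_⊎_)
open import Data.Empty using (⊥)
open import Relation.Nullary using (¬_)
open import Relation.Binary using (Rel; IsPartialOrder)
open import Relation.Binary.PropositionalEquality using (_≡_)
open import Relation.Binary.Construct.Closure.ReflexiveTransitive using (Star)

-- Presburger arithmetic: first-order logic over (ℕ, 0, 1, +, ≤, =)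
-- Formulas over m variables (de Bruijn: variable 0 is the innermost bound one).

data Term (m : ℕ) : Set where
  var   : Fin m → Term m
  const : ℕ → Term m
  _⊕_   : Term m → Term m → Term m

data Formula (m : ℕ) : Set where
  _≐_ _≼_ : Term m → Term m → Formula m
  ⊤ᶠ ⊥ᶠ   : Formula m
  ¬ᶠ_     : Formula m → Formula m
  _∧ᶠ_ _∨ᶠ_ _⇒ᶠ_ : Formula m → Formula m → Formula m
  ∃ᶠ ∀ᶠ   : Formula (Data.Nat.suc m) → Formula m

⟦_⟧t : ∀ {m} → Term m → Vec ℕ m → ℕ
⟦ var i ⟧t ρ = lookup ρ i
⟦ const c ⟧t ρ = c
⟦ s ⊕ t ⟧t ρ = ⟦ s ⟧t ρ +ℕ ⟦ t ⟧t ρ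

data ⊤' : Set where tt' : ⊤'

_⊨_ : ∀ {m} → Vec ℕ m → Formula m → Set
ρ ⊨ (s ≐ t) = ⟦ s ⟧t ρ ≡ ⟦ t ⟧t ρ
ρ ⊨ (s ≼ t) = ⟦ s ⟧t ρ ≤ℕ ⟦ t ⟧t ρ
ρ ⊨ ⊤ᶠ = ⊤'
ρ ⊨ ⊥ᶠ = ⊥
ρ ⊨ (¬ᶠ φ) = ¬ (ρ ⊨ φ)
ρ ⊨ (φ ∧ᶠ ψ) = (ρ ⊨ φ) × (ρ ⊨ ψ)
ρ ⊨ (φ ∨ᶠ ψ) = (ρ ⊨ φ) ⊎ (ρ ⊨ ψ)
ρ ⊨ (φ ⇒ᶠ ψ) = (ρ ⊨ φ) → (ρ ⊨ ψ)
ρ ⊨ (∃ᶠ φ) = Σ ℕ λ v → (v ∷ ρ) ⊨ φ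
ρ ⊨ (∀ᶠ φ) = (v : ℕ) → (v ∷ ρ) ⊨ φ

-- An affine partial function on ℕⁿ: Presburger domain, x ↦ A x + b,
-- A ∈ ℕ^{n×n} (rows), b ∈ ℤⁿ.
record AffineFun (n : ℕ) : Set where
  field
    dom : Formula n
    A   : Vec (Vec ℕ n) n
    b   : Vec ℤ n

dot : ∀ {n} → Vec ℕ n → Vec ℕ n → ℕ
dot u v = foldr _ _+ℕ_ 0 (zipWith Data.Nat._*_ u v)

applyℤ : ∀ {n} → AffineFun n → Vec ℕ n → Vec ℤ n
applyℤ f x = zipWith (λ row bi → (+ dot row x) +ℤ bi) (AffineFun.A f) (AffineFun.b f)

_↦[_]_ : ∀ {n} → Vec ℕ n → AffineFun n → Vec ℕ n → Set
x ↦[ f ] y = (x ⊨ AffineFun.dom f) × (applyℤ f x ≡ map +_ y)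

-- An ACS with n counters and k control states; the finite transition
-- relation → ⊆ Q × R × Q is given as a list of triples.
record ACS (n : ℕ) : Set where
  field
    k     : ℕ
    trans : List (Fin k × AffineFun n × Fin k)

State : ∀ {n} → ACS n → Set
State {n} C = Fin (ACS.k C) × Vec ℕ n

Step : ∀ {n} (C : ACS n) → Rel (State C) _
Step C (q , x) (q' , y) =
  Σ (AffineFun _) λ f → ((q , f , q') ∈ ACS.trans C) × (x ↦[ f ] y)

_≤S_ : ∀ {n} {C : ACS n} → Rel (State C) _
(q , x) ≤S (q' , y) = (q ≡ q') × Pointwise _≤ℕ_ x y

record OTS : Set₁ where
  field
    S    : Set
    _⟶_  : Rel S _
    _⊑_  : Rel S _

IsWellPartialOrder : {S : Set} → Rel S _ → Set
IsWellPartialOrder {S} _⊑_ =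
  IsPartialOrder _≡_ _⊑_ ×
  ((f : ℕ → S) → Σ ℕ λ i → Σ ℕ λ j → (i < j) × (f i ⊑ f j))

IsMonotonic : OTS → Set
IsMonotonic T = ∀ s s' s₁ → s ⟶ s' → s ⊑ s₁ →
  Σ S λ s₁' → Star _⟶_ s₁ s₁' × (s' ⊑ s₁')
  where open OTS T

IsStronglyMonotonic : OTS → Set
IsStronglyMonotonic T = ∀ s s' s₁ → s ⟶ s' → s ⊑ s₁ →
  Σ S λ s₁' → (s₁ ⟶ s₁') × (s' ⊑ s₁')
  where open OTS T

IsWSTS : OTS → Set
IsWSTS T = IsWellPartialOrder (OTS._⊑_ T) × IsMonotonic T

IsStronglyMonotonicWSTS : OTS → Set
IsStronglyMonotonicWSTS T = IsWSTS T × IsStronglyMonotonic T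

toOTS : ∀ {n} → ACS n → OTS
toOTS C = record { S = State C ; _⟶_ = Step C ; _⊑_ = _≤S_ {C = C} }

-- The order of C (equal control states, componentwise ≤ on counters) is
-- always a well partial order by Dickson's lemma, and strong monotonicity
-- implies monotonicity, so C is a strongly monotonic WSTS iff it is strongly
-- monotonic.  Strong monotonicity is the conjunction, over the transitions
-- t = (q, f, q′) of C, of the Presburger sentences
--     ∀ x y x₁. x ↦[f] y ∧ x ≤ x₁ → ⋁ over (q, f′, q′) of C of ∃ y₁. x₁ ↦[f′] y₁ ∧ y ≤ y₁,
-- and Presburger arithmetic is decidable.

module Submission where

open import Defs
open import Data.Nat using (ℕ)
open import Relation.Nullary using (Dec)

open import Data.Nat as ℕ using (zero; suc)
import Data.Nat.Properties as ℕP
open import Data.Integer as ℤ using (ℤ; +_; -[1+_]; _+_; _*_; -_; _-_; _<_; _≤_; _⊓_; 0ℤ; 1ℤ; -1ℤ)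
import Data.Integer.Properties as ℤP
open import Data.Integer.DivMod using (_%ℕ_; _/ℕ_; a≡a%ℕn+[a/ℕn]*n; n%ℕd<d)
open import Data.Integer.Divisibility.Signed
  using (_∣_; _∣?_; divides; ∣-trans; ∣-refl; ∣m∣n⇒∣m-n; ∣m∣n⇒∣m+n; ∣m⇒∣-m; *-monoʳ-∣; *-cancelˡ-∣)
open import Data.Integer.Tactic.RingSolver using (solve-∀)
open import Data.Fin as Fin using (Fin; _↑ˡ_; _↑ʳ_)
open import Data.Vec as V using (Vec; []; _∷_; _++_; lookup)
import Data.Vec.Properties as VP
open import Data.Vec.Relation.Binary.Pointwise.Inductive as Pointwise using (Pointwise; []; _∷_; Pointwise-≡⇒≡)
open import Data.Vec.Relation.Binary.Pointwise.Extensional using (ext; extensional⇒inductive)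
open import Data.List as L using (List; []; _∷_; upTo)
open import Data.List.Relation.Unary.All as All using (All; []; _∷_)
import Data.List.Relation.Unary.All.Properties as All
open import Data.List.Relation.Unary.Any as Any using (Any; here; there)
import Data.List.Relation.Unary.Any.Properties as Any
open import Data.List.Membership.Propositional using (_∈_; find; lose)
open import Data.Product using (Σ; ∃-syntax; _×_; _,_; proj₁; proj₂)
open import Data.Product.Function.NonDependent.Propositional using (_×-⇔_)
open import Data.Sum using (_⊎_; inj₁; inj₂)
open import Data.Sum.Function.Propositional using (_⊎-⇔_)
open import Data.Empty using (⊥; ⊥-elim)
open import Data.Unit using (⊤; tt)
open import Function.Base using (_∘_; id; _⟨_⟩_)
open import Function.Bundles using (_⇔_; mk⇔; module Equivalence)
import Function.Properties.Equivalence as ⇔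
open import Function.Related.TypeIsomorphisms using (¬-cong-⇔; →-cong-⇔)
open import Relation.Nullary using (¬_; yes; no)
open import Relation.Nullary.Decidable as Dec using (decidable-stable; _×-dec_; _⊎-dec_; ¬?)
open import Relation.Binary using (IsPartialOrder; Decidable)
open import Relation.Binary.PropositionalEquality
open import Relation.Binary.Construct.Closure.ReflexiveTransitive using (ε; _◅_)

open Equivalence using (to; from)


≡⇒⇔ : ∀ {A B : Set} → A ≡ B → A ⇔ B
≡⇒⇔ refl = ⇔.refl

Σ-⇔ : ∀ {V : Set} {P Q : V → Set} → (∀ v → P v ⇔ Q v) → Σ V P ⇔ Σ V Q
Σ-⇔ P⇔Q = mk⇔ (λ (v , p) → v , to (P⇔Q v) p) (λ (v , q) → v , from (P⇔Q v) q)

Π-⇔ : ∀ {V : Set} {P Q : V → Set} → (∀ v → P v ⇔ Q v) → ((v : V) → P v) ⇔ ((v : V) → Q v)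
Π-⇔ P⇔Q = mk⇔ (λ f v → to (P⇔Q v) (f v)) (λ g v → from (P⇔Q v) (g v))

Any-⇔ : ∀ {A : Set} {P Q : A → Set} xs → (∀ x → P x ⇔ Q x) → Any P xs ⇔ Any Q xs
Any-⇔ xs P⇔Q = mk⇔ (Any.map λ {x} → to (P⇔Q x)) (Any.map λ {x} → from (P⇔Q x))

→⇔¬⊎ : ∀ {A B : Set} → Dec A → (A → B) ⇔ ((¬ A) ⊎ B)
→⇔¬⊎ A? = mk⇔ (material A?) λ { (inj₁ ¬a) a → ⊥-elim (¬a a) ; (inj₂ b) _ → b }
  where
  material : ∀ {A B : Set} → Dec A → (A → B) → (¬ A) ⊎ B
  material (yes a) f = inj₂ (f a)
  material (no ¬a) f = inj₁ ¬a

dotZ : ∀ {m} → Vec ℤ m → Vec ℤ m → ℤ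
dotZ []       []       = 0ℤ
dotZ (c ∷ cs) (x ∷ xs) = c * x + dotZ cs xs

data Lin (m : ℕ) : Set where
  lin : ℤ → Vec ℤ m → Lin m

⟦_⟧L : ∀ {m} → Lin m → Vec ℤ m → ℤ
⟦ lin k cs ⟧L ρ = k + dotZ cs ρ

unitV : ∀ {m} → Fin m → Vec ℤ m
unitV Fin.zero    = 1ℤ ∷ V.replicate _ 0ℤ
unitV (Fin.suc i) = 0ℤ ∷ unitV i

constL : ∀ {m} → ℤ → Lin m
constL k = lin k (V.replicate _ 0ℤ)

varL : ∀ {m} → Fin m → Lin m
varL i = lin 0ℤ (unitV i)

addL : ∀ {m} → Lin m → Lin m → Lin m
addL (lin k cs) (lin k′ cs′) = lin (k + k′) (V.zipWith _+_ cs cs′)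

scaleL : ∀ {m} → ℤ → Lin m → Lin m
scaleL c (lin k cs) = lin (c * k) (V.map (c *_) cs)

dotZ-zeros : ∀ {m} (ρ : Vec ℤ m) → dotZ (V.replicate m 0ℤ) ρ ≡ 0ℤ
dotZ-zeros []      = refl
dotZ-zeros (x ∷ ρ) rewrite dotZ-zeros ρ = ℤP.*-zeroˡ x

dotZ-unit : ∀ {m} (i : Fin m) (ρ : Vec ℤ m) → dotZ (unitV i) ρ ≡ lookup ρ i
dotZ-unit Fin.zero    (x ∷ ρ) rewrite dotZ-zeros ρ = ℤP.+-identityʳ (1ℤ * x) ⟨ trans ⟩ ℤP.*-identityˡ x
dotZ-unit (Fin.suc i) (x ∷ ρ) rewrite dotZ-unit i ρ | ℤP.*-zeroˡ x = ℤP.+-identityˡ (lookup ρ i)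

dotZ-add : ∀ {m} (a b ρ : Vec ℤ m) → dotZ (V.zipWith _+_ a b) ρ ≡ dotZ a ρ + dotZ b ρ
dotZ-add []       []       []      = refl
dotZ-add (a ∷ as) (b ∷ bs) (x ∷ ρ) rewrite dotZ-add as bs ρ = lemma a b x (dotZ as ρ) (dotZ bs ρ)
  where
  lemma : ∀ a b x p q → (a + b) * x + (p + q) ≡ a * x + p + (b * x + q)
  lemma = solve-∀

dotZ-scale : ∀ {m} c (a ρ : Vec ℤ m) → dotZ (V.map (c *_) a) ρ ≡ c * dotZ a ρ
dotZ-scale c []       []      = sym (ℤP.*-zeroʳ c)
dotZ-scale c (a ∷ as) (x ∷ ρ) rewrite dotZ-scale c as ρ = lemma c a x (dotZ as ρ)
  where
  lemma : ∀ c a x p → c * a * x + c * p ≡ c * (a * x + p)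
  lemma = solve-∀

constL-sem : ∀ {m} k (ρ : Vec ℤ m) → ⟦ constL k ⟧L ρ ≡ k
constL-sem k ρ rewrite dotZ-zeros ρ = ℤP.+-identityʳ k

varL-sem : ∀ {m} (i : Fin m) ρ → ⟦ varL i ⟧L ρ ≡ lookup ρ i
varL-sem i ρ rewrite dotZ-unit i ρ = ℤP.+-identityˡ (lookup ρ i)

addL-sem : ∀ {m} (a b : Lin m) ρ → ⟦ addL a b ⟧L ρ ≡ ⟦ a ⟧L ρ + ⟦ b ⟧L ρ
addL-sem (lin k cs) (lin k′ cs′) ρ rewrite dotZ-add cs cs′ ρ = lemma k k′ (dotZ cs ρ) (dotZ cs′ ρ)
  where
  lemma : ∀ a b c d → a + b + (c + d) ≡ a + c + (b + d)
  lemma = solve-∀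

scaleL-sem : ∀ {m} c (a : Lin m) ρ → ⟦ scaleL c a ⟧L ρ ≡ c * ⟦ a ⟧L ρ
scaleL-sem c (lin k cs) ρ rewrite dotZ-scale c cs ρ = sym (ℤP.*-distribˡ-+ c k (dotZ cs ρ))

-- Quantifier-free Presburger formulas over ℤ: positivity of a linear term,
-- divisibility of a term by a positive constant (written as its predecessor
-- d, meaning suc d ∣ t) and its negation, closed under ∧ and ∨.
data QF (m : ℕ) : Set where
  ttQ ffQ   : QF m
  pos       : Lin m → QF m
  dvd ndvd  : ℕ → Lin m → QF m
  _∧Q_ _∨Q_ : QF m → QF m → QF m

⟦_⟧Q : ∀ {m} → QF m → Vec ℤ m → Set
⟦ ttQ ⟧Q      ρ = ⊤
⟦ ffQ ⟧Q      ρ = ⊥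
⟦ pos t ⟧Q    ρ = 0ℤ < ⟦ t ⟧L ρ
⟦ dvd d t ⟧Q  ρ = + suc d ∣ ⟦ t ⟧L ρ
⟦ ndvd d t ⟧Q ρ = ¬ (+ suc d ∣ ⟦ t ⟧L ρ)
⟦ φ ∧Q ψ ⟧Q   ρ = ⟦ φ ⟧Q ρ × ⟦ ψ ⟧Q ρ
⟦ φ ∨Q ψ ⟧Q   ρ = ⟦ φ ⟧Q ρ ⊎ ⟦ ψ ⟧Q ρ

QF? : ∀ {m} (φ : QF m) ρ → Dec (⟦ φ ⟧Q ρ)
QF? ttQ        ρ = yes tt
QF? ffQ        ρ = no λ ()
QF? (pos t)    ρ = 0ℤ ℤ.<? ⟦ t ⟧L ρ
QF? (dvd d t)  ρ = + suc d ∣? ⟦ t ⟧L ρ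
QF? (ndvd d t) ρ = ¬? (+ suc d ∣? ⟦ t ⟧L ρ)
QF? (φ ∧Q ψ)   ρ = QF? φ ρ ×-dec QF? ψ ρ
QF? (φ ∨Q ψ)   ρ = QF? φ ρ ⊎-dec QF? ψ ρ

-- Over ℤ, ¬ (0 < z) iff 0 < 1 - z, so positivity atoms are closed under negation.
¬pos⇔pos[1-z] : ∀ z → (¬ (0ℤ < z)) ⇔ 0ℤ < 1ℤ - z
¬pos⇔pos[1-z] z = mk⇔ fwd bwd
  where
  fwd : ¬ (0ℤ < z) → 0ℤ < 1ℤ - z
  fwd z≯0 = ℤP.<-≤-trans (ℤ.+<+ (ℕ.s≤s ℕ.z≤n)) (ℤP.+-monoʳ-≤ 1ℤ (ℤP.neg-mono-≤ (ℤP.≮⇒≥ z≯0)))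
  bwd : 0ℤ < 1ℤ - z → ¬ (0ℤ < z)
  bwd 0<1-z 0<z = ℤP.<-irrefl refl (ℤP.<-≤-trans (ℤP.+-mono-<-≤ 0<1-z (ℤP.i<j⇒suc[i]≤j 0<z))
                                      (ℤP.≤-reflexive (lemma z)))
    where
    lemma : ∀ z → 1ℤ - z + z ≡ 0ℤ + 1ℤ
    lemma = solve-∀

negL : ∀ {m} → Lin m → Lin m
negL t = addL (constL 1ℤ) (scaleL -1ℤ t)

negL-sem : ∀ {m} (t : Lin m) ρ → ⟦ negL t ⟧L ρ ≡ 1ℤ - ⟦ t ⟧L ρ
negL-sem t ρ rewrite addL-sem (constL 1ℤ) (scaleL -1ℤ t) ρ | constL-sem 1ℤ ρ
                   | scaleL-sem -1ℤ t ρ | ℤP.-1*i≡-i (⟦ t ⟧L ρ) = refl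

negQ : ∀ {m} → QF m → QF m
negQ ttQ        = ffQ
negQ ffQ        = ttQ
negQ (pos t)    = pos (negL t)
negQ (dvd d t)  = ndvd d t
negQ (ndvd d t) = dvd d t
negQ (φ ∧Q ψ)   = negQ φ ∨Q negQ ψ
negQ (φ ∨Q ψ)   = negQ φ ∧Q negQ ψ

negQ-sem : ∀ {m} (φ : QF m) ρ → ⟦ negQ φ ⟧Q ρ ⇔ (¬ ⟦ φ ⟧Q ρ)
negQ-sem ttQ        ρ = mk⇔ (λ ()) (λ ¬⊤ → ¬⊤ tt)
negQ-sem ffQ        ρ = mk⇔ (λ _ ()) (λ _ → tt)
negQ-sem (pos t)    ρ rewrite negL-sem t ρ = ⇔.sym (¬pos⇔pos[1-z] (⟦ t ⟧L ρ))
negQ-sem (dvd d t)  ρ = ⇔.refl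
negQ-sem (ndvd d t) ρ = mk⇔ (λ p ¬p → ¬p p) (decidable-stable (+ suc d ∣? ⟦ t ⟧L ρ))
negQ-sem (φ ∧Q ψ)   ρ = mk⇔ fwd bwd
  where
  fwd : ⟦ negQ φ ⟧Q ρ ⊎ ⟦ negQ ψ ⟧Q ρ → ¬ (⟦ φ ⟧Q ρ × ⟦ ψ ⟧Q ρ)
  fwd (inj₁ ¬φ) (p , _) = to (negQ-sem φ ρ) ¬φ p
  fwd (inj₂ ¬ψ) (_ , q) = to (negQ-sem ψ ρ) ¬ψ q
  bwd : ¬ (⟦ φ ⟧Q ρ × ⟦ ψ ⟧Q ρ) → ⟦ negQ φ ⟧Q ρ ⊎ ⟦ negQ ψ ⟧Q ρ
  bwd ¬φψ with QF? φ ρ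
  ... | no ¬p = inj₁ (from (negQ-sem φ ρ) ¬p)
  ... | yes p = inj₂ (from (negQ-sem ψ ρ) (λ q → ¬φψ (p , q)))
negQ-sem (φ ∨Q ψ)   ρ = mk⇔ fwd bwd
  where
  fwd : ⟦ negQ φ ⟧Q ρ × ⟦ negQ ψ ⟧Q ρ → ¬ (⟦ φ ⟧Q ρ ⊎ ⟦ ψ ⟧Q ρ)
  fwd (¬φ , _) (inj₁ p) = to (negQ-sem φ ρ) ¬φ p
  fwd (_ , ¬ψ) (inj₂ q) = to (negQ-sem ψ ρ) ¬ψ q
  bwd : ¬ (⟦ φ ⟧Q ρ ⊎ ⟦ ψ ⟧Q ρ) → ⟦ negQ φ ⟧Q ρ × ⟦ negQ ψ ⟧Q ρ
  bwd ¬φψ = from (negQ-sem φ ρ) (¬φψ ∘ inj₁) , from (negQ-sem ψ ρ) (¬φψ ∘ inj₂)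

⋁ : ∀ {m} {A : Set} → List A → (A → QF m) → QF m
⋁ []       f = ffQ
⋁ (x ∷ xs) f = f x ∨Q ⋁ xs f

⋁-sem : ∀ {m} {A : Set} (xs : List A) (f : A → QF m) ρ → ⟦ ⋁ xs f ⟧Q ρ ⇔ Any (λ x → ⟦ f x ⟧Q ρ) xs
⋁-sem []       f ρ = mk⇔ (λ ()) (λ ())
⋁-sem (x ∷ xs) f ρ = mk⇔
  (λ { (inj₁ p) → here p ; (inj₂ q) → there (to (⋁-sem xs f ρ) q) })
  (λ { (here p) → inj₁ p ; (there q) → inj₂ (from (⋁-sem xs f ρ) q) })

-- Positive numbers are handled through their predecessors; this is the
-- product in that encoding: suc (a ⊗ b) = suc a * suc b definitionally.
infixl 7 _⊗_
_⊗_ : ℕ → ℕ → ℕ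
a ⊗ b = b ℕ.+ a ℕ.* suc b

∣-⊗ˡ : ∀ a b {z} → + suc (a ⊗ b) ∣ z → + suc a ∣ z
∣-⊗ˡ a b = ∣-trans (divides (+ suc b) (trans (ℤP.pos-* (suc a) (suc b)) (ℤP.*-comm (+ suc a) (+ suc b))))

∣-⊗ʳ : ∀ a b {z} → + suc (a ⊗ b) ∣ z → + suc b ∣ z
∣-⊗ʳ a b = ∣-trans (divides (+ suc a) (ℤP.pos-* (suc a) (suc b)))

∣-shift : ∀ {k} y y′ t → k ∣ y - y′ → (k ∣ y + t) ⇔ (k ∣ y′ + t)
∣-shift {k} y y′ t k∣y-y′ = mk⇔
  (λ k∣y+t → subst (k ∣_) (lemma₁ y y′ t) (∣m∣n⇒∣m-n k∣y+t k∣y-y′))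
  (λ k∣y′+t → subst (k ∣_) (lemma₂ y y′ t) (∣m∣n⇒∣m+n k∣y′+t k∣y-y′))
  where
  lemma₁ : ∀ y y′ t → y + t - (y - y′) ≡ y′ + t
  lemma₁ = solve-∀
  lemma₂ : ∀ y y′ t → y′ + t + (y - y′) ≡ y + t
  lemma₂ = solve-∀

-- Formulas in one distinguished variable y (kept outside the valuation ρ)
-- in which y occurs only with coefficient ±1: the input of Cooper's method.
data U (m : ℕ) : Set where
  free       : QF m → U m
  posP posM  : Lin m → U m
  dvdP ndvdP : ℕ → Lin m → U m
  _∧U_ _∨U_  : U m → U m → U m

⟦_⟧U : ∀ {m} → U m → ℤ → Vec ℤ m → Set
⟦ free ψ ⟧U    y ρ = ⟦ ψ ⟧Q ρ
⟦ posP t ⟧U    y ρ = 0ℤ < y + ⟦ t ⟧L ρ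
⟦ posM t ⟧U    y ρ = 0ℤ < - y + ⟦ t ⟧L ρ
⟦ dvdP d t ⟧U  y ρ = + suc d ∣ y + ⟦ t ⟧L ρ
⟦ ndvdP d t ⟧U y ρ = ¬ (+ suc d ∣ y + ⟦ t ⟧L ρ)
⟦ φ ∧U ψ ⟧U    y ρ = ⟦ φ ⟧U y ρ × ⟦ ψ ⟧U y ρ
⟦ φ ∨U ψ ⟧U    y ρ = ⟦ φ ⟧U y ρ ⊎ ⟦ ψ ⟧U y ρ

substU : ∀ {m} → U m → Lin m → QF m
substU (free ψ)    s = ψ
substU (posP t)    s = pos (addL s t)
substU (posM t)    s = pos (addL (scaleL -1ℤ s) t)
substU (dvdP d t)  s = dvd d (addL s t)
substU (ndvdP d t) s = ndvd d (addL s t)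
substU (φ ∧U ψ)    s = substU φ s ∧Q substU ψ s
substU (φ ∨U ψ)    s = substU φ s ∨Q substU ψ s

substU-sem : ∀ {m} (φ : U m) s ρ → ⟦ substU φ s ⟧Q ρ ⇔ ⟦ φ ⟧U (⟦ s ⟧L ρ) ρ
substU-sem (free ψ)    s ρ = ⇔.refl
substU-sem (posP t)    s ρ rewrite addL-sem s t ρ = ⇔.refl
substU-sem (posM t)    s ρ rewrite addL-sem (scaleL -1ℤ s) t ρ | scaleL-sem -1ℤ s ρ
                                 | ℤP.-1*i≡-i (⟦ s ⟧L ρ) = ⇔.refl
substU-sem (dvdP d t)  s ρ rewrite addL-sem s t ρ = ⇔.refl
substU-sem (ndvdP d t) s ρ rewrite addL-sem s t ρ = ⇔.refl
substU-sem (φ ∧U ψ)    s ρ = substU-sem φ s ρ ×-⇔ substU-sem ψ s ρ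
substU-sem (φ ∨U ψ)    s ρ = substU-sem φ s ρ ⊎-⇔ substU-sem ψ s ρ

-- The formula φ at y → -∞: lower-bound atoms become false, upper-bound atoms true.
minf : ∀ {m} → U m → U m
minf (posP t) = free ffQ
minf (posM t) = free ttQ
minf (φ ∧U ψ) = minf φ ∧U minf ψ
minf (φ ∨U ψ) = minf φ ∨U minf ψ
minf φ        = φ

-- The terms t of the lower-bound atoms 0 < y + t (the "B-set", negated).
bounds : ∀ {m} → U m → List (Lin m)
bounds (posP t) = t ∷ []
bounds (φ ∧U ψ) = bounds φ L.++ bounds ψ
bounds (φ ∨U ψ) = bounds φ L.++ bounds ψ
bounds φ        = []

-- A common multiple of all divisors (predecessor encoding): the period of minf φ.
δ : ∀ {m} → U m → ℕ
δ (dvdP d t)  = d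
δ (ndvdP d t) = d
δ (φ ∧U ψ)    = δ φ ⊗ δ ψ
δ (φ ∨U ψ)    = δ φ ⊗ δ ψ
δ φ           = 0

minf-periodic : ∀ {m} (φ : U m) y y′ ρ → + suc (δ φ) ∣ y - y′ → ⟦ minf φ ⟧U y ρ → ⟦ minf φ ⟧U y′ ρ
minf-periodic (free ψ)    y y′ ρ D∣ p = p
minf-periodic (posM t)    y y′ ρ D∣ p = tt
minf-periodic (dvdP d t)  y y′ ρ D∣ p = to (∣-shift y y′ (⟦ t ⟧L ρ) D∣) p
minf-periodic (ndvdP d t) y y′ ρ D∣ p = to (¬-cong-⇔ (∣-shift y y′ (⟦ t ⟧L ρ) D∣)) p
minf-periodic (φ ∧U ψ)    y y′ ρ D∣ (p , q) =
  minf-periodic φ y y′ ρ (∣-⊗ˡ (δ φ) (δ ψ) D∣) p , minf-periodic ψ y y′ ρ (∣-⊗ʳ (δ φ) (δ ψ) D∣) q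
minf-periodic (φ ∨U ψ)    y y′ ρ D∣ (inj₁ p) = inj₁ (minf-periodic φ y y′ ρ (∣-⊗ˡ (δ φ) (δ ψ) D∣) p)
minf-periodic (φ ∨U ψ)    y y′ ρ D∣ (inj₂ q) = inj₂ (minf-periodic ψ y y′ ρ (∣-⊗ʳ (δ φ) (δ ψ) D∣) q)

minf-threshold : ∀ {m} (φ : U m) ρ → ∃[ M ] (∀ y → y ≤ M → ⟦ φ ⟧U y ρ ⇔ ⟦ minf φ ⟧U y ρ)
minf-threshold (free ψ)    ρ = 0ℤ , λ _ _ → ⇔.refl
minf-threshold (dvdP d t)  ρ = 0ℤ , λ _ _ → ⇔.refl
minf-threshold (ndvdP d t) ρ = 0ℤ , λ _ _ → ⇔.refl
minf-threshold (posP t)    ρ = - ⟦ t ⟧L ρ , λ y y≤-t →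
  mk⇔ (λ 0<y+t → ℤP.<-irrefl refl (ℤP.<-≤-trans 0<y+t (y+t≤0 y≤-t))) λ ()
  where
  y+t≤0 : ∀ {y} → y ≤ - ⟦ t ⟧L ρ → y + ⟦ t ⟧L ρ ≤ 0ℤ
  y+t≤0 y≤-t = ℤP.≤-trans (ℤP.+-monoˡ-≤ (⟦ t ⟧L ρ) y≤-t) (ℤP.≤-reflexive (ℤP.+-inverseˡ (⟦ t ⟧L ρ)))
minf-threshold (posM t)    ρ = ⟦ t ⟧L ρ - 1ℤ , λ y y≤t-1 → mk⇔ (λ _ → tt) (λ _ → 0<-y+t y≤t-1)
  where
  0<-y+t : ∀ {y} → y ≤ ⟦ t ⟧L ρ - 1ℤ → 0ℤ < - y + ⟦ t ⟧L ρ
  0<-y+t {y} y≤t-1 = ℤP.suc[i]≤j⇒i<j (subst (_≤ - y + ⟦ t ⟧L ρ) (lemma y) (ℤP.+-monoʳ-≤ (- y) y+1≤t))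
    where
    y+1≤t : y + 1ℤ ≤ ⟦ t ⟧L ρ
    y+1≤t = subst (y + 1ℤ ≤_) (lemma′ (⟦ t ⟧L ρ)) (ℤP.+-monoˡ-≤ 1ℤ y≤t-1)
      where
      lemma′ : ∀ t → t - 1ℤ + 1ℤ ≡ t
      lemma′ = solve-∀
    lemma : ∀ y → - y + (y + 1ℤ) ≡ 1ℤ + 0ℤ
    lemma = solve-∀
minf-threshold (φ ∧U ψ) ρ with minf-threshold φ ρ | minf-threshold ψ ρ
... | M₁ , agree₁ | M₂ , agree₂ = M₁ ⊓ M₂ , λ y y≤M →
  agree₁ y (ℤP.≤-trans y≤M (ℤP.i⊓j≤i M₁ M₂)) ×-⇔ agree₂ y (ℤP.≤-trans y≤M (ℤP.i⊓j≤j M₁ M₂))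
minf-threshold (φ ∨U ψ) ρ with minf-threshold φ ρ | minf-threshold ψ ρ
... | M₁ , agree₁ | M₂ , agree₂ = M₁ ⊓ M₂ , λ y y≤M →
  agree₁ y (ℤP.≤-trans y≤M (ℤP.i⊓j≤i M₁ M₂)) ⊎-⇔ agree₂ y (ℤP.≤-trans y≤M (ℤP.i⊓j≤j M₁ M₂))

InWindow : ∀ {m} → ℤ → Vec ℤ m → ℕ → Lin m → Set
InWindow y ρ D t = 0ℤ < y + ⟦ t ⟧L ρ × y + ⟦ t ⟧L ρ ≤ + D

∣-step : ∀ {k D} y → k ∣ D → k ∣ y - (y - D)
∣-step {k} {D} y = subst (k ∣_) (lemma y D)
  where
  lemma : ∀ y D → D ≡ y - (y - D)
  lemma = solve-∀

descend : ∀ {m} (φ : U m) y ρ D → + suc (δ φ) ∣ + D → All (λ t → ¬ InWindow y ρ D t) (bounds φ) →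
          ⟦ φ ⟧U y ρ → ⟦ φ ⟧U (y - + D) ρ
descend (free ψ)    y ρ D D∣ outside p = p
descend (posP t)    y ρ D D∣ (outside ∷ []) 0<y+t with y + ⟦ t ⟧L ρ ℤ.≤? + D
... | yes y+t≤D = ⊥-elim (outside (0<y+t , y+t≤D))
... | no  y+t≰D = subst₂ _<_ (ℤP.+-inverseʳ (+ D)) (lemma y (+ D) (⟦ t ⟧L ρ))
                    (ℤP.+-monoˡ-< (- + D) (ℤP.≰⇒> y+t≰D))
  where
  lemma : ∀ y D t → y + t - D ≡ y - D + t
  lemma = solve-∀
descend (posM t)    y ρ D D∣ outside 0<-y+t =
  ℤP.<-≤-trans 0<-y+t (ℤP.≤-trans (ℤP.i≤i+j _ (+ D)) (ℤP.≤-reflexive (lemma y (+ D) (⟦ t ⟧L ρ))))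
  where
  lemma : ∀ y D t → - y + t + D ≡ - (y - D) + t
  lemma = solve-∀
descend (dvdP d t)  y ρ D D∣ outside p = to (∣-shift y (y - + D) (⟦ t ⟧L ρ) (∣-step y D∣)) p
descend (ndvdP d t) y ρ D D∣ outside p = to (¬-cong-⇔ (∣-shift y (y - + D) (⟦ t ⟧L ρ) (∣-step y D∣))) p
descend (φ ∧U ψ)    y ρ D D∣ outside (p , q) with All.++⁻ (bounds φ) outside
... | outside₁ , outside₂ = descend φ y ρ D (∣-⊗ˡ (δ φ) (δ ψ) D∣) outside₁ p
                          , descend ψ y ρ D (∣-⊗ʳ (δ φ) (δ ψ) D∣) outside₂ q
descend (φ ∨U ψ)    y ρ D D∣ outside (inj₁ p) =
  inj₁ (descend φ y ρ D (∣-⊗ˡ (δ φ) (δ ψ) D∣) (proj₁ (All.++⁻ (bounds φ) outside)) p)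
descend (φ ∨U ψ)    y ρ D D∣ outside (inj₂ q) =
  inj₂ (descend ψ y ρ D (∣-⊗ʳ (δ φ) (δ ψ) D∣) (proj₂ (All.++⁻ (bounds φ) outside)) q)

-- The test points for the lower bound t: y = - t + (1 + j), for j < D.
candidate : ∀ {m} → Lin m → ℕ → Lin m
candidate t j = addL (scaleL -1ℤ t) (constL (+ suc j))

candidate-sem : ∀ {m} (t : Lin m) j ρ → ⟦ candidate t j ⟧L ρ ≡ - ⟦ t ⟧L ρ + + suc j
candidate-sem t j ρ rewrite addL-sem (scaleL -1ℤ t) (constL (+ suc j)) ρ | scaleL-sem -1ℤ t ρ
                          | constL-sem {_} (+ suc j) ρ | ℤP.-1*i≡-i (⟦ t ⟧L ρ) = refl

-- Cooper's elimination of ∃y: either minf φ holds at a residue j < D,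
-- or φ holds at a test point of some lower bound.
elimU : ∀ {m} → U m → QF m
elimU φ = ⋁ (upTo D) (λ j → substU (minf φ) (constL (+ j)))
       ∨Q ⋁ (bounds φ) (λ t → ⋁ (upTo D) (λ j → substU φ (candidate t j)))
  where
  D : ℕ
  D = suc (δ φ)

i≤+∣i∣ : ∀ i → i ≤ + ℤ.∣ i ∣
i≤+∣i∣ (+ n)    = ℤP.≤-refl
i≤+∣i∣ -[1+ n ] = ℤ.-≤+

-- If minf φ holds somewhere, then (by periodicity) it holds below the
-- threshold, where it agrees with φ.
minf⇒sat : ∀ {m} (φ : U m) ρ z → ⟦ minf φ ⟧U z ρ → ∃[ y ] ⟦ φ ⟧U y ρ
minf⇒sat φ ρ z p with minf-threshold φ ρ
... | M , agree = y , from (agree y y≤M) (minf-periodic φ z y ρ D∣z-y p)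
  where
  open ℤP.≤-Reasoning
  D K : ℕ
  D = suc (δ φ)
  K = ℤ.∣ z - M ∣
  y : ℤ
  y = z - + K * + D
  D∣z-y : + D ∣ z - y
  D∣z-y = divides (+ K) (lemma z (+ K) (+ D))
    where
    lemma : ∀ z K D → z - (z - K * D) ≡ K * D
    lemma = solve-∀
  K≤K*D : + K ≤ + K * + D
  K≤K*D = ℤP.≤-trans (ℤ.+≤+ (ℕP.m≤m*n K D)) (ℤP.≤-reflexive (ℤP.pos-* K D))
  y≤M : y ≤ M
  y≤M = begin
    z - + K * + D ≤⟨ ℤP.+-monoʳ-≤ z (ℤP.neg-mono-≤ K≤K*D) ⟩
    z - + K       ≤⟨ ℤP.+-monoʳ-≤ z (ℤP.neg-mono-≤ (i≤+∣i∣ (z - M))) ⟩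
    z - (z - M)   ≡⟨ lemma z M ⟩
    M             ∎
    where
    lemma : ∀ z M → z - (z - M) ≡ M
    lemma = solve-∀

elimU-sound : ∀ {m} (φ : U m) ρ → ⟦ elimU φ ⟧Q ρ → ∃[ y ] ⟦ φ ⟧U y ρ
elimU-sound φ ρ (inj₁ atResidue) with Any.satisfied (to (⋁-sem (upTo _) _ ρ) atResidue)
... | j , minf[j] = minf⇒sat φ ρ (+ j)
  (subst (λ z → ⟦ minf φ ⟧U z ρ) (constL-sem (+ j) ρ) (to (substU-sem (minf φ) (constL (+ j)) ρ) minf[j]))
elimU-sound φ ρ (inj₂ atBound) with Any.satisfied (to (⋁-sem (bounds φ) _ ρ) atBound)
... | t , atCandidate with Any.satisfied (to (⋁-sem (upTo _) _ ρ) atCandidate)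
... | j , φ[c] = ⟦ candidate t j ⟧L ρ , to (substU-sem φ (candidate t j) ρ) φ[c]

-- Completeness: from a solution y, descend in steps of D until either y lies
-- below the threshold (then minf φ holds at y mod D) or some bound puts y + t
-- into the window (0, D] (then y is a test point of t).
module Completeness {m} (φ : U m) (ρ : Vec ℤ m) where
  D : ℕ
  D = suc (δ φ)
  M : ℤ
  M = proj₁ (minf-threshold φ ρ)
  agree : ∀ y → y ≤ M → ⟦ φ ⟧U y ρ ⇔ ⟦ minf φ ⟧U y ρ
  agree = proj₂ (minf-threshold φ ρ)

  viaMinf : ∀ y → ⟦ minf φ ⟧U y ρ → ⟦ elimU φ ⟧Q ρ
  viaMinf y minf[y] = inj₁ (from (⋁-sem (upTo D) _ ρ) (Any.applyUpTo⁺ id minf[r] (n%ℕd<d y D)))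
    where
    r : ℕ
    r = y %ℕ D
    D∣y-r : + D ∣ y - + r
    D∣y-r = divides (y /ℕ D) (trans (cong (_- + r) (a≡a%ℕn+[a/ℕn]*n y D)) (lemma (+ r) ((y /ℕ D) * + D)))
      where
      lemma : ∀ r s → r + s - r ≡ s
      lemma = solve-∀
    minf[r] : ⟦ substU (minf φ) (constL (+ r)) ⟧Q ρ
    minf[r] = from (substU-sem (minf φ) (constL (+ r)) ρ)
      (subst (λ z → ⟦ minf φ ⟧U z ρ) (sym (constL-sem (+ r) ρ)) (minf-periodic φ y (+ r) ρ D∣y-r minf[y]))

  viaBound : ∀ y → ⟦ φ ⟧U y ρ → Any (InWindow y ρ D) (bounds φ) → ⟦ elimU φ ⟧Q ρ
  viaBound y φ[y] inWindow =
    inj₂ (from (⋁-sem (bounds φ) (λ t → ⋁ (upTo D) (λ j → substU φ (candidate t j))) ρ)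
               (Any.map (λ {t} → atCandidate {t}) inWindow))
    where
    atCandidate : ∀ {t} → InWindow y ρ D t → ⟦ ⋁ (upTo D) (λ j → substU φ (candidate t j)) ⟧Q ρ
    atCandidate {t} (0<w , w≤D) = from (⋁-sem (upTo D) _ ρ) (Any.applyUpTo⁺ id φ[c] (ℤP.drop‿+<+ j<D))
      where
      w : ℤ
      w = y + ⟦ t ⟧L ρ
      j : ℕ
      j = ℤ.∣ w - 1ℤ ∣
      +j≡w-1 : + j ≡ w - 1ℤ
      +j≡w-1 = ℤP.0≤i⇒+∣i∣≡i (ℤP.i≤j⇒0≤j-i (ℤP.i<j⇒suc[i]≤j 0<w))
      j<D : + j < + D
      j<D = subst (_< + D) (sym +j≡w-1) (ℤP.<-≤-trans (ℤP.i≤pred[j]⇒i<j (ℤP.≤-reflexive (ℤP.+-comm w -1ℤ))) w≤D)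
      y≡c : y ≡ ⟦ candidate t j ⟧L ρ
      y≡c = sym (trans (candidate-sem t j ρ) (trans (cong (λ z → - ⟦ t ⟧L ρ + (1ℤ + z)) +j≡w-1)
                                                   (lemma y (⟦ t ⟧L ρ))))
        where
        lemma : ∀ y t → - t + (1ℤ + (y + t - 1ℤ)) ≡ y
        lemma = solve-∀
      φ[c] : ⟦ substU φ (candidate t j) ⟧Q ρ
      φ[c] = from (substU-sem φ (candidate t j) ρ) (subst (λ z → ⟦ φ ⟧U z ρ) y≡c φ[y])

  InWindow? : ∀ y t → Dec (InWindow y ρ D t)
  InWindow? y t = (0ℤ ℤ.<? y + ⟦ t ⟧L ρ) ×-dec (y + ⟦ t ⟧L ρ ℤ.≤? + D)

  -- The invariant y ≤ M + N bounds the number of descent steps by N.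
  descent : ∀ N y → y ≤ M + + N → ⟦ φ ⟧U y ρ → ⟦ elimU φ ⟧Q ρ
  descent N y y≤M+N φ[y] with y ℤ.≤? M
  ... | yes y≤M = viaMinf y (to (agree y y≤M) φ[y])
  ... | no  y≰M with Any.any? (InWindow? y) (bounds φ)
  ... | yes inWindow = viaBound y φ[y] inWindow
  ... | no  ¬inWindow with N
  ... | zero  = ⊥-elim (y≰M (subst (y ≤_) (ℤP.+-identityʳ M) y≤M+N))
  ... | suc N = descent N (y - + D) y-D≤M+N
                  (descend φ y ρ D ∣-refl (All.¬Any⇒All¬ (bounds φ) ¬inWindow) φ[y])
    where
    open ℤP.≤-Reasoning
    y-D≤M+N : y - + D ≤ M + + N
    y-D≤M+N = begin
      y - + D               ≤⟨ ℤP.+-monoʳ-≤ y (ℤP.neg-mono-≤ (ℤ.+≤+ (ℕ.s≤s ℕ.z≤n))) ⟩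
      y - 1ℤ                ≤⟨ ℤP.+-monoˡ-≤ -1ℤ y≤M+N ⟩
      M + + suc N - 1ℤ      ≡⟨ lemma M (+ N) ⟩
      M + + N               ∎
      where
      lemma : ∀ M N → M + (1ℤ + N) - 1ℤ ≡ M + N
      lemma = solve-∀

elimU-complete : ∀ {m} (φ : U m) ρ y → ⟦ φ ⟧U y ρ → ⟦ elimU φ ⟧Q ρ
elimU-complete φ ρ y = Completeness.descent φ ρ ℤ.∣ y - M ∣ y y≤M+∣y-M∣
  where
  M : ℤ
  M = Completeness.M φ ρ
  y≤M+∣y-M∣ : y ≤ M + + ℤ.∣ y - M ∣
  y≤M+∣y-M∣ = ℤP.≤-trans (ℤP.≤-reflexive (lemma y M)) (ℤP.+-monoʳ-≤ M (i≤+∣i∣ (y - M)))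
    where
    lemma : ∀ y M → y ≡ M + (y - M)
    lemma = solve-∀

elimU-sem : ∀ {m} (φ : U m) ρ → ⟦ elimU φ ⟧Q ρ ⇔ (∃[ y ] ⟦ φ ⟧U y ρ)
elimU-sem φ ρ = mk⇔ (elimU-sound φ ρ) (λ (y , φ[y]) → elimU-complete φ ρ y φ[y])

-- Elimination of an arbitrary ∃x: scale every atom so that x gets
-- coefficient ±L (L a common multiple of all coefficients of x), then
-- replace L·x by a fresh y, constrained by L ∣ y.

coefPred : ∀ {m} → Lin (suc m) → ℕ
coefPred (lin k (+ zero ∷ cs))  = 0
coefPred (lin k (+ suc a ∷ cs)) = a
coefPred (lin k (-[1+ a ] ∷ cs)) = a

-- Predecessor of the common multiple L of all coefficients of x.
coefL : ∀ {m} → QF (suc m) → ℕ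
coefL (pos t)    = coefPred t
coefL (dvd d t)  = coefPred t
coefL (ndvd d t) = coefPred t
coefL (φ ∧Q ψ)   = coefL φ ⊗ coefL ψ
coefL (φ ∨Q ψ)   = coefL φ ⊗ coefL ψ
coefL _          = 0

-- normU e φ is φ multiplied through by (suc e) · L / |c| in each atom, read
-- as a formula in y = (suc e) · L · x (see normU-sem).
normU : ∀ {m} → ℕ → QF (suc m) → U m
normU e ttQ                            = free ttQ
normU e ffQ                            = free ffQ
normU e (pos (lin k (+ zero ∷ cs)))    = free (pos (lin k cs))
normU e (pos (lin k (+ suc a ∷ cs)))   = posP (scaleL (+ suc e) (lin k cs))
normU e (pos (lin k (-[1+ a ] ∷ cs)))  = posM (scaleL (+ suc e) (lin k cs))
normU e (dvd d (lin k (+ zero ∷ cs)))  = free (dvd d (lin k cs))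
normU e (dvd d (lin k (+ suc a ∷ cs))) = dvdP (e ⊗ d) (scaleL (+ suc e) (lin k cs))
normU e (dvd d (lin k (-[1+ a ] ∷ cs))) = dvdP (e ⊗ d) (scaleL (- + suc e) (lin k cs))
normU e (ndvd d (lin k (+ zero ∷ cs)))  = free (ndvd d (lin k cs))
normU e (ndvd d (lin k (+ suc a ∷ cs))) = ndvdP (e ⊗ d) (scaleL (+ suc e) (lin k cs))
normU e (ndvd d (lin k (-[1+ a ] ∷ cs))) = ndvdP (e ⊗ d) (scaleL (- + suc e) (lin k cs))
normU e (φ ∧Q ψ) = normU (e ⊗ coefL ψ) φ ∧U normU (e ⊗ coefL φ) ψ
normU e (φ ∨Q ψ) = normU (e ⊗ coefL ψ) φ ∨U normU (e ⊗ coefL φ) ψ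

pos-scale : ∀ e z → (0ℤ < + suc e * z) ⇔ (0ℤ < z)
pos-scale e z = mk⇔
  (λ 0<ez → ℤP.*-cancelˡ-<-nonNeg (+ suc e) (subst (_< + suc e * z) (sym (ℤP.*-zeroʳ (+ suc e))) 0<ez))
  (λ 0<z → subst (_< + suc e * z) (ℤP.*-zeroʳ (+ suc e)) (ℤP.*-monoˡ-<-pos (+ suc e) 0<z))

dvd-scale : ∀ e d z → (+ suc (e ⊗ d) ∣ + suc e * z) ⇔ (+ suc d ∣ z)
dvd-scale e d z rewrite ℤP.pos-* (suc e) (suc d) = mk⇔ (*-cancelˡ-∣ (+ suc e)) (*-monoʳ-∣ (+ suc e))

dvd-neg : ∀ k z → (k ∣ - z) ⇔ (k ∣ z)
dvd-neg k z = mk⇔ (λ k∣-z → subst (k ∣_) (ℤP.neg-involutive z) (∣m⇒∣-m k∣-z)) ∣m⇒∣-m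

module _ {m} (e a : ℕ) (x : ℤ) (k : ℤ) (cs : Vec ℤ m) (ρ : Vec ℤ m) where
  private
    y r : ℤ
    y = + suc e * + suc a * x
    r = dotZ cs ρ

  scaled-posCoef : + suc e * ⟦ lin k (+ suc a ∷ cs) ⟧L (x ∷ ρ) ≡ y + ⟦ scaleL (+ suc e) (lin k cs) ⟧L ρ
  scaled-posCoef rewrite scaleL-sem (+ suc e) (lin k cs) ρ = lemma (+ suc e) (+ suc a) x k r
    where
    lemma : ∀ E A x k r → E * (k + (A * x + r)) ≡ E * A * x + E * (k + r)
    lemma = solve-∀

  scaled-negCoef : + suc e * ⟦ lin k (-[1+ a ] ∷ cs) ⟧L (x ∷ ρ) ≡ - y + ⟦ scaleL (+ suc e) (lin k cs) ⟧L ρ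
  scaled-negCoef rewrite scaleL-sem (+ suc e) (lin k cs) ρ = lemma (+ suc e) (+ suc a) x k r
    where
    lemma : ∀ E A x k r → E * (k + (- A * x + r)) ≡ - (E * A * x) + E * (k + r)
    lemma = solve-∀

  scaled-negCoef′ : - (+ suc e * ⟦ lin k (-[1+ a ] ∷ cs) ⟧L (x ∷ ρ)) ≡ y + ⟦ scaleL (- + suc e) (lin k cs) ⟧L ρ
  scaled-negCoef′ rewrite scaleL-sem (- + suc e) (lin k cs) ρ = lemma (+ suc e) (+ suc a) x k r
    where
    lemma : ∀ E A x k r → - (E * (k + (- A * x + r))) ≡ E * A * x + (- E) * (k + r)
    lemma = solve-∀

zeroCoef : ∀ {m} k (cs : Vec ℤ m) x ρ → ⟦ lin k cs ⟧L ρ ≡ ⟦ lin k (+ zero ∷ cs) ⟧L (x ∷ ρ)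
zeroCoef k cs x ρ = cong (λ z → k + z) (sym (ℤP.+-identityˡ (dotZ cs ρ)))

-- Regrouping of y when the factor L splits over a conjunction or disjunction.
regroupˡ : ∀ e a b x → + suc e * + suc (a ⊗ b) * x ≡ + suc (e ⊗ b) * + suc a * x
regroupˡ e a b x rewrite ℤP.pos-* (suc a) (suc b) | ℤP.pos-* (suc e) (suc b) = lemma (+ suc e) (+ suc a) (+ suc b) x
  where
  lemma : ∀ E A B x → E * (A * B) * x ≡ E * B * A * x
  lemma = solve-∀

regroupʳ : ∀ e a b x → + suc e * + suc (a ⊗ b) * x ≡ + suc (e ⊗ a) * + suc b * x
regroupʳ e a b x rewrite ℤP.pos-* (suc a) (suc b) | ℤP.pos-* (suc e) (suc a) = lemma (+ suc e) (+ suc a) (+ suc b) x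
  where
  lemma : ∀ E A B x → E * (A * B) * x ≡ E * A * B * x
  lemma = solve-∀

normU-sem : ∀ {m} (φ : QF (suc m)) e x ρ →
            ⟦ normU e φ ⟧U (+ suc e * + suc (coefL φ) * x) ρ ⇔ ⟦ φ ⟧Q (x ∷ ρ)
normU-sem ttQ e x ρ = ⇔.refl
normU-sem ffQ e x ρ = ⇔.refl
normU-sem (pos (lin k (+ zero ∷ cs))) e x ρ = ≡⇒⇔ (cong (0ℤ <_) (zeroCoef k cs x ρ))
normU-sem (pos (lin k (+ suc a ∷ cs))) e x ρ =
  ⇔.trans (≡⇒⇔ (cong (0ℤ <_) (sym (scaled-posCoef e a x k cs ρ)))) (pos-scale e _)
normU-sem (pos (lin k (-[1+ a ] ∷ cs))) e x ρ =
  ⇔.trans (≡⇒⇔ (cong (0ℤ <_) (sym (scaled-negCoef e a x k cs ρ)))) (pos-scale e _)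
normU-sem (dvd d (lin k (+ zero ∷ cs))) e x ρ = ≡⇒⇔ (cong (+ suc d ∣_) (zeroCoef k cs x ρ))
normU-sem (dvd d (lin k (+ suc a ∷ cs))) e x ρ =
  ⇔.trans (≡⇒⇔ (cong (+ suc (e ⊗ d) ∣_) (sym (scaled-posCoef e a x k cs ρ)))) (dvd-scale e d _)
normU-sem (dvd d (lin k (-[1+ a ] ∷ cs))) e x ρ =
  ⇔.trans (≡⇒⇔ (cong (+ suc (e ⊗ d) ∣_) (sym (scaled-negCoef′ e a x k cs ρ))))
          (⇔.trans (dvd-neg _ _) (dvd-scale e d _))
normU-sem (ndvd d (lin k (+ zero ∷ cs))) e x ρ = ≡⇒⇔ (cong (λ z → ¬ (+ suc d ∣ z)) (zeroCoef k cs x ρ))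
normU-sem (ndvd d (lin k (+ suc a ∷ cs))) e x ρ = ¬-cong-⇔
  (⇔.trans (≡⇒⇔ (cong (+ suc (e ⊗ d) ∣_) (sym (scaled-posCoef e a x k cs ρ)))) (dvd-scale e d _))
normU-sem (ndvd d (lin k (-[1+ a ] ∷ cs))) e x ρ = ¬-cong-⇔
  (⇔.trans (≡⇒⇔ (cong (+ suc (e ⊗ d) ∣_) (sym (scaled-negCoef′ e a x k cs ρ))))
           (⇔.trans (dvd-neg _ _) (dvd-scale e d _)))
normU-sem (φ ∧Q ψ) e x ρ = regroup φ (regroupˡ e (coefL φ) (coefL ψ) x) ×-⇔ regroup ψ (regroupʳ e (coefL φ) (coefL ψ) x)
  where
  regroup : ∀ χ {e′ y} → y ≡ + suc e′ * + suc (coefL χ) * x → ⟦ normU e′ χ ⟧U y ρ ⇔ ⟦ χ ⟧Q (x ∷ ρ)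
  regroup χ {e′} eq = subst (λ y → ⟦ normU e′ χ ⟧U y ρ ⇔ ⟦ χ ⟧Q (x ∷ ρ)) (sym eq) (normU-sem χ e′ x ρ)
normU-sem (φ ∨Q ψ) e x ρ = regroup φ (regroupˡ e (coefL φ) (coefL ψ) x) ⊎-⇔ regroup ψ (regroupʳ e (coefL φ) (coefL ψ) x)
  where
  regroup : ∀ χ {e′ y} → y ≡ + suc e′ * + suc (coefL χ) * x → ⟦ normU e′ χ ⟧U y ρ ⇔ ⟦ χ ⟧Q (x ∷ ρ)
  regroup χ {e′} eq = subst (λ y → ⟦ normU e′ χ ⟧U y ρ ⇔ ⟦ χ ⟧Q (x ∷ ρ)) (sym eq) (normU-sem χ e′ x ρ)

-- Elimination of ∃x from an arbitrary quantifier-free formula: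
-- ∃x. φ(x)  ⇔  ∃y. L ∣ y ∧ φ′(y), where φ′ is φ normalised to y = L·x.
elim : ∀ {m} → QF (suc m) → QF m
elim φ = elimU (dvdP (coefL φ) (constL 0ℤ) ∧U normU 0 φ)

elim-sem : ∀ {m} (φ : QF (suc m)) ρ → ⟦ elim φ ⟧Q ρ ⇔ (∃[ x ] ⟦ φ ⟧Q (x ∷ ρ))
elim-sem φ ρ = ⇔.trans (elimU-sem (dvdP (coefL φ) (constL 0ℤ) ∧U normU 0 φ) ρ) (mk⇔ fwd bwd)
  where
  L : ℤ
  L = + suc (coefL φ)
  y≡L*x : ∀ x → + 1 * L * x ≡ x * L
  y≡L*x x = trans (cong (_* x) (ℤP.*-identityˡ L)) (ℤP.*-comm L x)
  fwd : (∃[ y ] ⟦ dvdP (coefL φ) (constL 0ℤ) ∧U normU 0 φ ⟧U y ρ) → ∃[ x ] ⟦ φ ⟧Q (x ∷ ρ)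
  fwd (y , L∣y+0 , φ′[y]) with subst (λ z → L ∣ y + z) (constL-sem 0ℤ ρ) L∣y+0
  ... | divides x y+0≡x*L = x , to (normU-sem φ 0 x ρ)
          (subst (λ z → ⟦ normU 0 φ ⟧U z ρ) (trans (sym (ℤP.+-identityʳ y)) (trans y+0≡x*L (sym (y≡L*x x)))) φ′[y])
  bwd : (∃[ x ] ⟦ φ ⟧Q (x ∷ ρ)) → ∃[ y ] ⟦ dvdP (coefL φ) (constL 0ℤ) ∧U normU 0 φ ⟧U y ρ
  bwd (x , φ[x]) = + 1 * L * x
                 , subst (λ z → L ∣ + 1 * L * x + z) (sym (constL-sem 0ℤ ρ))
                         (divides x (trans (ℤP.+-identityʳ _) (y≡L*x x)))
                 , from (normU-sem φ 0 x ρ) φ[x]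

-- Quantification over ℕ, expressed through the nonnegativity atom 0 < x₀ + 1.
nonneg₀ : ∀ {m} → QF (suc m)
nonneg₀ = pos (lin 1ℤ (1ℤ ∷ V.replicate _ 0ℤ))

nonneg₀-sem : ∀ {m} z (ρ : Vec ℤ m) → ⟦ nonneg₀ ⟧Q (z ∷ ρ) ⇔ (0ℤ ≤ z)
nonneg₀-sem z ρ rewrite dotZ-zeros ρ | ℤP.+-identityʳ (1ℤ * z) | ℤP.*-identityˡ z = mk⇔ fwd bwd
  where
  fwd : 0ℤ < 1ℤ + z → 0ℤ ≤ z
  fwd 0<1+z = subst₂ _≤_ (lemma 0ℤ) (lemma z) (ℤP.+-monoʳ-≤ -1ℤ (ℤP.i<j⇒suc[i]≤j 0<1+z))
    where
    lemma : ∀ z → -1ℤ + (1ℤ + z) ≡ z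
    lemma = solve-∀
  bwd : 0ℤ ≤ z → 0ℤ < 1ℤ + z
  bwd 0≤z = ℤP.<-≤-trans (ℤ.+<+ (ℕ.s≤s ℕ.z≤n)) (ℤP.+-monoʳ-≤ 1ℤ 0≤z)

exℕ : ∀ {m} → QF (suc m) → QF m
exℕ ψ = elim (nonneg₀ ∧Q ψ)

exℕ-sem : ∀ {m} (ψ : QF (suc m)) ρ → ⟦ exℕ ψ ⟧Q ρ ⇔ (∃[ v ] ⟦ ψ ⟧Q (+ v ∷ ρ))
exℕ-sem ψ ρ = ⇔.trans (elim-sem (nonneg₀ ∧Q ψ) ρ) (mk⇔ toℕ fromℕ)
  where
  toℕ : (∃[ z ] ⟦ nonneg₀ ∧Q ψ ⟧Q (z ∷ ρ)) → ∃[ v ] ⟦ ψ ⟧Q (+ v ∷ ρ)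
  toℕ (z , z≥0 , ψ[z]) =
    ℤ.∣ z ∣ , subst (λ w → ⟦ ψ ⟧Q (w ∷ ρ)) (sym (ℤP.0≤i⇒+∣i∣≡i (to (nonneg₀-sem z ρ) z≥0))) ψ[z]
  fromℕ : (∃[ v ] ⟦ ψ ⟧Q (+ v ∷ ρ)) → ∃[ z ] ⟦ nonneg₀ ∧Q ψ ⟧Q (z ∷ ρ)
  fromℕ (v , ψ[v]) = + v , from (nonneg₀-sem (+ v) ρ) (ℤ.+≤+ ℕ.z≤n) , ψ[v]

allℕ : ∀ {m} → QF (suc m) → QF m
allℕ ψ = negQ (exℕ (negQ ψ))

allℕ-sem : ∀ {m} (ψ : QF (suc m)) ρ → ⟦ allℕ ψ ⟧Q ρ ⇔ (∀ v → ⟦ ψ ⟧Q (+ v ∷ ρ))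
allℕ-sem ψ ρ = ⇔.trans (negQ-sem (exℕ (negQ ψ)) ρ)
               (⇔.trans (¬-cong-⇔ (⇔.trans (exℕ-sem (negQ ψ) ρ) (Σ-⇔ λ v → negQ-sem ψ (+ v ∷ ρ))))
                        (mk⇔ (λ ¬∃¬ v → decidable-stable (QF? ψ (+ v ∷ ρ)) (λ ¬ψ → ¬∃¬ (v , ¬ψ)))
                             (λ ∀ψ (v , ¬ψ) → ¬ψ (∀ψ v))))

≤⇔0<1+[j-i] : ∀ i j → (i ≤ j) ⇔ (0ℤ < 1ℤ + (j - i))
≤⇔0<1+[j-i] i j = mk⇔ fwd bwd
  where
  fwd : i ≤ j → 0ℤ < 1ℤ + (j - i)
  fwd i≤j = ℤP.suc[i]≤j⇒i<j (ℤP.+-monoʳ-≤ 1ℤ (ℤP.i≤j⇒0≤j-i i≤j))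
  bwd : 0ℤ < 1ℤ + (j - i) → i ≤ j
  bwd 0<1+j-i = subst₂ _≤_ (trans (lemma i 0ℤ) (ℤP.+-identityˡ i)) (trans (lemma i (j - i)) (lemma′ i j))
                  (ℤP.+-monoˡ-≤ i (ℤP.+-monoʳ-≤ -1ℤ (ℤP.i<j⇒suc[i]≤j 0<1+j-i)))
    where
    lemma : ∀ i z → -1ℤ + (1ℤ + z) + i ≡ z + i
    lemma = solve-∀
    lemma′ : ∀ i j → j - i + i ≡ j
    lemma′ = solve-∀

leQ : ∀ {m} → Lin m → Lin m → QF m
leQ s t = pos (addL (constL 1ℤ) (addL t (scaleL -1ℤ s)))

leQ-sem : ∀ {m} (s t : Lin m) ρ → (⟦ s ⟧L ρ ≤ ⟦ t ⟧L ρ) ⇔ ⟦ leQ s t ⟧Q ρ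
leQ-sem s t ρ rewrite addL-sem (constL 1ℤ) (addL t (scaleL -1ℤ s)) ρ | constL-sem 1ℤ ρ
                    | addL-sem t (scaleL -1ℤ s) ρ | scaleL-sem -1ℤ s ρ | ℤP.-1*i≡-i (⟦ s ⟧L ρ) =
  ≤⇔0<1+[j-i] (⟦ s ⟧L ρ) (⟦ t ⟧L ρ)

-- Renaming of variables: p says where each variable of the formula is found
-- in the larger valuation.
select : ∀ {k m} → (Fin k → Fin m) → Vec ℤ m → Vec ℤ k
select p ρ = V.tabulate (lookup ρ ∘ p)

renL : ∀ {k m} → (Fin k → Fin m) → Lin k → Lin m
renL p (lin c [])       = constL c
renL p (lin c (a ∷ as)) = addL (scaleL a (varL (p Fin.zero))) (renL (p ∘ Fin.suc) (lin c as))

renL-sem : ∀ {k m} (p : Fin k → Fin m) t ρ → ⟦ renL p t ⟧L ρ ≡ ⟦ t ⟧L (select p ρ)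
renL-sem p (lin c [])       ρ = trans (constL-sem c ρ) (sym (ℤP.+-identityʳ c))
renL-sem p (lin c (a ∷ as)) ρ
  rewrite addL-sem (scaleL a (varL (p Fin.zero))) (renL (p ∘ Fin.suc) (lin c as)) ρ
        | scaleL-sem a (varL (p Fin.zero)) ρ | varL-sem (p Fin.zero) ρ
        | renL-sem (p ∘ Fin.suc) (lin c as) ρ = lemma a (lookup ρ (p Fin.zero)) c (dotZ as (select (p ∘ Fin.suc) ρ))
  where
  lemma : ∀ a x c r → a * x + (c + r) ≡ c + (a * x + r)
  lemma = solve-∀

renQ : ∀ {k m} → (Fin k → Fin m) → QF k → QF m
renQ p ttQ        = ttQ
renQ p ffQ        = ffQ
renQ p (pos t)    = pos (renL p t)
renQ p (dvd d t)  = dvd d (renL p t)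
renQ p (ndvd d t) = ndvd d (renL p t)
renQ p (φ ∧Q ψ)   = renQ p φ ∧Q renQ p ψ
renQ p (φ ∨Q ψ)   = renQ p φ ∨Q renQ p ψ

renQ-sem : ∀ {k m} (p : Fin k → Fin m) φ ρ → ⟦ renQ p φ ⟧Q ρ ⇔ ⟦ φ ⟧Q (select p ρ)
renQ-sem p ttQ        ρ = ⇔.refl
renQ-sem p ffQ        ρ = ⇔.refl
renQ-sem p (pos t)    ρ = ≡⇒⇔ (cong (0ℤ <_) (renL-sem p t ρ))
renQ-sem p (dvd d t)  ρ = ≡⇒⇔ (cong (+ suc d ∣_) (renL-sem p t ρ))
renQ-sem p (ndvd d t) ρ = ≡⇒⇔ (cong (λ z → ¬ (+ suc d ∣ z)) (renL-sem p t ρ))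
renQ-sem p (φ ∧Q ψ)   ρ = renQ-sem p φ ρ ×-⇔ renQ-sem p ψ ρ
renQ-sem p (φ ∨Q ψ)   ρ = renQ-sem p φ ρ ⊎-⇔ renQ-sem p ψ ρ

trT : ∀ {m} → Term m → Lin m
trT (var i)   = varL i
trT (const c) = constL (+ c)
trT (s ⊕ t)   = addL (trT s) (trT t)

trT-sem : ∀ {m} (t : Term m) ρ → ⟦ trT t ⟧L (V.map +_ ρ) ≡ + ⟦ t ⟧t ρ
trT-sem (var i)   ρ = trans (varL-sem i (V.map +_ ρ)) (VP.lookup-map i +_ ρ)
trT-sem (const c) ρ = constL-sem (+ c) (V.map +_ ρ)
trT-sem (s ⊕ t)   ρ rewrite addL-sem (trT s) (trT t) (V.map +_ ρ) | trT-sem s ρ | trT-sem t ρ = refl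

trF : ∀ {m} → Formula m → QF m
trF (s ≐ t)  = leQ (trT s) (trT t) ∧Q leQ (trT t) (trT s)
trF (s ≼ t)  = leQ (trT s) (trT t)
trF ⊤ᶠ       = ttQ
trF ⊥ᶠ       = ffQ
trF (¬ᶠ φ)   = negQ (trF φ)
trF (φ ∧ᶠ ψ) = trF φ ∧Q trF ψ
trF (φ ∨ᶠ ψ) = trF φ ∨Q trF ψ
trF (φ ⇒ᶠ ψ) = negQ (trF φ) ∨Q trF ψ
trF (∃ᶠ φ)   = exℕ (trF φ)
trF (∀ᶠ φ)   = allℕ (trF φ)

trT-≤ : ∀ {m} (s t : Term m) ρ → (⟦ s ⟧t ρ ℕ.≤ ⟦ t ⟧t ρ) ⇔ ⟦ leQ (trT s) (trT t) ⟧Q (V.map +_ ρ)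
trT-≤ s t ρ = ⇔.trans (mk⇔ ℤ.+≤+ ℤP.drop‿+≤+)
              (⇔.trans (≡⇒⇔ (cong₂ _≤_ (sym (trT-sem s ρ)) (sym (trT-sem t ρ))))
                       (leQ-sem (trT s) (trT t) (V.map +_ ρ)))

trF-sem : ∀ {m} (φ : Formula m) ρ → (ρ ⊨ φ) ⇔ ⟦ trF φ ⟧Q (V.map +_ ρ)
trF-sem (s ≐ t)  ρ = ⇔.trans (mk⇔ (λ s≡t → ℕP.≤-reflexive s≡t , ℕP.≤-reflexive (sym s≡t))
                                   (λ (s≤t , t≤s) → ℕP.≤-antisym s≤t t≤s))
                             (trT-≤ s t ρ ×-⇔ trT-≤ t s ρ)
trF-sem (s ≼ t)  ρ = trT-≤ s t ρ
trF-sem ⊤ᶠ       ρ = mk⇔ (λ _ → tt) (λ _ → tt')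
trF-sem ⊥ᶠ       ρ = ⇔.refl
trF-sem (¬ᶠ φ)   ρ = ⇔.trans (¬-cong-⇔ (trF-sem φ ρ)) (⇔.sym (negQ-sem (trF φ) (V.map +_ ρ)))
trF-sem (φ ∧ᶠ ψ) ρ = trF-sem φ ρ ×-⇔ trF-sem ψ ρ
trF-sem (φ ∨ᶠ ψ) ρ = trF-sem φ ρ ⊎-⇔ trF-sem ψ ρ
trF-sem (φ ⇒ᶠ ψ) ρ = ⇔.trans (→-cong-⇔ (trF-sem φ ρ) (trF-sem ψ ρ))
                     (⇔.trans (→⇔¬⊎ (QF? (trF φ) (V.map +_ ρ)))
                              (⇔.sym (negQ-sem (trF φ) (V.map +_ ρ)) ⊎-⇔ ⇔.refl))
trF-sem (∃ᶠ φ)   ρ = ⇔.trans (Σ-⇔ λ v → trF-sem φ (v ∷ ρ)) (⇔.sym (exℕ-sem (trF φ) (V.map +_ ρ)))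
trF-sem (∀ᶠ φ)   ρ = ⇔.trans (Π-⇔ λ v → trF-sem φ (v ∷ ρ)) (⇔.sym (allℕ-sem (trF φ) (V.map +_ ρ)))

Definable : ∀ m → (Vec ℤ m → Set) → Set
Definable m P = Σ (QF m) λ ψ → ∀ ρ → P ρ ⇔ ⟦ ψ ⟧Q ρ

definable⇒dec : ∀ {m} {P : Vec ℤ m → Set} → Definable m P → ∀ ρ → Dec (P ρ)
definable⇒dec (ψ , P⇔ψ) ρ = Dec.map (⇔.sym (P⇔ψ ρ)) (QF? ψ ρ)

def-⇔ : ∀ {m} {P Q : Vec ℤ m → Set} → (∀ ρ → P ρ ⇔ Q ρ) → Definable m P → Definable m Q
def-⇔ P⇔Q (ψ , P⇔ψ) = ψ , λ ρ → ⇔.trans (⇔.sym (P⇔Q ρ)) (P⇔ψ ρ)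

def-const : ∀ {m} {A : Set} → Dec A → Definable m (λ _ → A)
def-const (yes a) = ttQ , λ _ → mk⇔ (λ _ → tt) (λ _ → a)
def-const (no ¬a) = ffQ , λ _ → mk⇔ ¬a (λ ())

def-× : ∀ {m} {P Q : Vec ℤ m → Set} → Definable m P → Definable m Q → Definable m (λ ρ → P ρ × Q ρ)
def-× (ψ , P⇔ψ) (χ , Q⇔χ) = ψ ∧Q χ , λ ρ → P⇔ψ ρ ×-⇔ Q⇔χ ρ

def-→ : ∀ {m} {P Q : Vec ℤ m → Set} → Definable m P → Definable m Q → Definable m (λ ρ → P ρ → Q ρ)
def-→ (ψ , P⇔ψ) (χ , Q⇔χ) = negQ ψ ∨Q χ , λ ρ →
  ⇔.trans (→-cong-⇔ (P⇔ψ ρ) (Q⇔χ ρ))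
          (⇔.trans (→⇔¬⊎ (QF? ψ ρ)) (⇔.sym (negQ-sem ψ ρ) ⊎-⇔ ⇔.refl))

def-Any : ∀ {m} {A : Set} {P : A → Vec ℤ m → Set} (xs : List A) → (∀ x → Definable m (P x)) →
          Definable m (λ ρ → Any (λ x → P x ρ) xs)
def-Any xs d = ⋁ xs (proj₁ ∘ d) , λ ρ →
  ⇔.sym (⇔.trans (⋁-sem xs (proj₁ ∘ d) ρ) (Any-⇔ xs λ x → ⇔.sym (proj₂ (d x) ρ)))

def-∀Fin : ∀ {m} k {P : Fin k → Vec ℤ m → Set} → (∀ i → Definable m (P i)) →
           Definable m (λ ρ → ∀ i → P i ρ)
def-∀Fin zero    d = def-⇔ (λ ρ → mk⇔ (λ _ ()) (λ _ → tt)) (def-const {A = ⊤} (yes tt))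
def-∀Fin (suc k) d = def-⇔ (λ ρ → mk⇔ (λ (p₀ , p) → λ { Fin.zero → p₀ ; (Fin.suc i) → p i })
                                       (λ p → p Fin.zero , p ∘ Fin.suc))
                           (def-× (d Fin.zero) (def-∀Fin k (d ∘ Fin.suc)))

def-∃ℕ : ∀ {m} {P : Vec ℤ (suc m) → Set} → Definable (suc m) P → Definable m (λ ρ → ∃[ v ] P (+ v ∷ ρ))
def-∃ℕ (ψ , P⇔ψ) = exℕ ψ , λ ρ → ⇔.trans (Σ-⇔ λ v → P⇔ψ (+ v ∷ ρ)) (⇔.sym (exℕ-sem ψ ρ))

def-∀ℕ : ∀ {m} {P : Vec ℤ (suc m) → Set} → Definable (suc m) P → Definable m (λ ρ → ∀ v → P (+ v ∷ ρ))
def-∀ℕ (ψ , P⇔ψ) = allℕ ψ , λ ρ → ⇔.trans (Π-⇔ λ v → P⇔ψ (+ v ∷ ρ)) (⇔.sym (allℕ-sem ψ ρ))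

def-∃ℕᵏ : ∀ {m} k {P : Vec ℤ (k ℕ.+ m) → Set} → Definable (k ℕ.+ m) P →
          Definable m (λ ρ → ∃[ v ] P (V.map +_ v V.++ ρ))
def-∃ℕᵏ zero    d = def-⇔ (λ ρ → mk⇔ (λ p → [] , p) (λ { ([] , p) → p })) d
def-∃ℕᵏ (suc k) d = def-⇔ (λ ρ → mk⇔ (λ (vs , v , p) → v ∷ vs , p) (λ { (v ∷ vs , p) → vs , v , p }))
                          (def-∃ℕᵏ k (def-∃ℕ d))

def-∀ℕᵏ : ∀ {m} k {P : Vec ℤ (k ℕ.+ m) → Set} → Definable (k ℕ.+ m) P →
          Definable m (λ ρ → ∀ v → P (V.map +_ v V.++ ρ))
def-∀ℕᵏ zero    d = def-⇔ (λ ρ → mk⇔ (λ p → λ { [] → p }) (λ p → p [])) d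
def-∀ℕᵏ (suc k) d = def-⇔ (λ ρ → mk⇔ (λ p → λ { (v ∷ vs) → p vs v }) (λ p vs v → p (v ∷ vs)))
                          (def-∀ℕᵏ k (def-∀ℕ d))

def-≤ : ∀ {m} (s t : Lin m) → Definable m (λ ρ → ⟦ s ⟧L ρ ≤ ⟦ t ⟧L ρ)
def-≤ s t = leQ s t , leQ-sem s t

def-≡ : ∀ {m} (s t : Lin m) → Definable m (λ ρ → ⟦ s ⟧L ρ ≡ ⟦ t ⟧L ρ)
def-≡ s t = def-⇔ (λ ρ → mk⇔ (λ (s≤t , t≤s) → ℤP.≤-antisym s≤t t≤s)
                             (λ s≡t → ℤP.≤-reflexive s≡t , ℤP.≤-reflexive (sym s≡t)))
                  (def-× (def-≤ s t) (def-≤ t s))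

def-select : ∀ {k m} (p : Fin k → Fin m) (φ : QF k) → Definable m (λ ρ → ⟦ φ ⟧Q (select p ρ))
def-select p φ = renQ p φ , λ ρ → ⇔.sym (renQ-sem p φ ρ)

-- Almost-full relations (Vytiniotis, Coquand, Wahlstedt): R is almost full
-- if it is total, or if for every x the relation "R, or x R ·" is almost full.
-- This is the constructive content of being a well-quasi-order.
data AlmostFull {A : Set} : (A → A → Set) → Set₁ where
  now   : ∀ {R} → (∀ x y → R x y) → AlmostFull R
  later : ∀ {R} → (∀ x → AlmostFull (λ y z → R y z ⊎ R x y)) → AlmostFull R

af-mono : ∀ {A : Set} {R S : A → A → Set} → AlmostFull R → (∀ {x y} → R x y → S x y) → AlmostFull S
af-mono (now R-total) R⊆S = now (λ x y → R⊆S (R-total x y))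
af-mono (later afR)   R⊆S = later λ x → af-mono (afR x) λ { (inj₁ r) → inj₁ (R⊆S r) ; (inj₂ r) → inj₂ (R⊆S r) }

af-comap : ∀ {A B : Set} {R : A → A → Set} → AlmostFull R → (g : B → A) → AlmostFull (λ y z → R (g y) (g z))
af-comap (now R-total) g = now (λ x y → R-total (g x) (g y))
af-comap (later afR)   g = later λ x → af-comap (afR (g x)) g

af-good : ∀ {A : Set} {R : A → A → Set} → AlmostFull R → (f : ℕ → A) →
          Σ ℕ λ i → Σ ℕ λ j → (i ℕ.< j) × R (f i) (f j)
af-good (now R-total) f = 0 , 1 , ℕ.s≤s ℕ.z≤n , R-total (f 0) (f 1)
af-good (later afR)   f with af-good (afR (f 0)) (f ∘ suc)
... | i , j , i<j , inj₁ r = suc i , suc j , ℕ.s≤s i<j , r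
... | i , j , i<j , inj₂ r = 0 , suc i , ℕ.s≤s ℕ.z≤n , r

-- The natural numbers: after seeing x, every y ≥ x is already good.
af-≤-above : ∀ x → AlmostFull (λ y z → y ℕ.≤ z ⊎ x ℕ.≤ y)
af-≤-above zero    = now (λ _ _ → inj₂ ℕ.z≤n)
af-≤-above (suc x) = later step
  where
  step : ∀ w → AlmostFull (λ y z → (y ℕ.≤ z ⊎ suc x ℕ.≤ y) ⊎ (w ℕ.≤ y ⊎ suc x ℕ.≤ w))
  step w with suc x ℕ.≤? w
  ... | yes x<w = now (λ _ _ → inj₂ (inj₂ x<w))
  ... | no  x≮w = af-mono (af-≤-above x) λ
    { (inj₁ y≤z) → inj₁ (inj₁ y≤z)
    ; (inj₂ x≤y) → inj₂ (inj₁ (ℕP.≤-trans (ℕP.≤-pred (ℕP.≰⇒> x≮w)) x≤y)) }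

af-ℕ : AlmostFull ℕ._≤_
af-ℕ = later af-≤-above

merge : ∀ {T P Q : Set} → T ⊎ P → T ⊎ Q → T ⊎ (P × Q)
merge (inj₁ t) _        = inj₁ t
merge (inj₂ _) (inj₁ t) = inj₁ t
merge (inj₂ p) (inj₂ q) = inj₂ (p , q)

-- Case analysis on two decisions (kept as a combinator so that the
-- recursive calls of af-union stay visible to the termination checker).
by-cases : ∀ {c} {A B : Set} {C : Set c} → Dec A → Dec B → (A → B → C) → (¬ A → C) → (¬ B → C) → C
by-cases (yes a) (yes b) both _     _     = both a b
by-cases (no ¬a) _       _    not-a _     = not-a ¬a
by-cases (yes _) (no ¬b) _    _     not-b = not-b ¬b

module _ {A : Set} where

  af-union : ∀ {U V T : A → A → Set} {P Q : A → Set} → AlmostFull U → AlmostFull V →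
             (∀ y → Dec (P y)) → (∀ y → Dec (Q y)) →
             (∀ {y z} → U y z → T y z ⊎ P y) → (∀ {y z} → V y z → T y z ⊎ Q y) →
             AlmostFull (λ y z → T y z ⊎ (P y × Q y))
  af-union (now U-total) afV P? Q? U⊆ V⊆ = af-mono afV λ v → merge (U⊆ (U-total _ _)) (V⊆ v)
  af-union (later afU) (now V-total) P? Q? U⊆ V⊆ = af-mono (later afU) λ u → merge (U⊆ u) (V⊆ (V-total _ _))
  af-union {U} {V} {T} {P} {Q} (later afU) (later afV) P? Q? U⊆ V⊆ = later λ x →
    by-cases (P? x) (Q? x)
      (λ p q → now (λ _ _ → inj₂ (inj₂ (p , q))))
      (λ ¬p → af-mono (af-union (afU x) (later afV) P? Q? (relativise {U} x ¬p U⊆) (enlarge {V} x V⊆)) regroup)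
      (λ ¬q → af-mono (af-union (later afU) (afV x) P? Q? (enlarge {U} x U⊆) (relativise {V} x ¬q V⊆)) regroup)
    where
    relativise : ∀ {W} {S : A → Set} x → ¬ S x → (∀ {y z} → W y z → T y z ⊎ S y) →
                 ∀ {y z} → W y z ⊎ W x y → (T y z ⊎ T x y) ⊎ S y
    relativise x ¬Sx W⊆ (inj₁ w) with W⊆ w
    ... | inj₁ t = inj₁ (inj₁ t)
    ... | inj₂ s = inj₂ s
    relativise x ¬Sx W⊆ (inj₂ w) with W⊆ w
    ... | inj₁ t = inj₁ (inj₂ t)
    ... | inj₂ s = ⊥-elim (¬Sx s)
    enlarge : ∀ {W} {S : A → Set} x → (∀ {y z} → W y z → T y z ⊎ S y) →
              ∀ {y z} → W y z → (T y z ⊎ T x y) ⊎ S y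
    enlarge x W⊆ w with W⊆ w
    ... | inj₁ t = inj₁ (inj₁ t)
    ... | inj₂ s = inj₂ s
    regroup : ∀ {x y z} → (T y z ⊎ T x y) ⊎ (P y × Q y) → (T y z ⊎ (P y × Q y)) ⊎ (T x y ⊎ (P x × Q x))
    regroup (inj₁ (inj₁ t)) = inj₁ (inj₁ t)
    regroup (inj₁ (inj₂ t)) = inj₂ (inj₁ t)
    regroup (inj₂ pq)       = inj₁ (inj₂ pq)

  af-∩ : ∀ {R S : A → A → Set} → AlmostFull R → AlmostFull S → Decidable R → Decidable S →
         AlmostFull (λ y z → R y z × S y z)
  af-∩ (now R-total) afS R? S? = af-mono afS λ s → R-total _ _ , s
  af-∩ (later afR) (now S-total) R? S? = af-mono (later afR) λ r → r , S-total _ _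
  af-∩ (later afR) (later afS) R? S? = later λ x →
    af-union (af-∩ (afR x) (later afS) (λ y z → R? y z ⊎-dec R? x y) S?)
             (af-∩ (later afR) (afS x) R? (λ y z → S? y z ⊎-dec S? x y))
             (R? x) (S? x)
             (λ { (inj₁ r , s) → inj₁ (r , s) ; (inj₂ r , _) → inj₂ r })
             (λ { (r , inj₁ s) → inj₁ (r , s) ; (_ , inj₂ s) → inj₂ s })

af-ℕⁿ : ∀ n → AlmostFull (Pointwise ℕ._≤_ {n} {n})
af-ℕⁿ zero    = now λ { [] [] → [] }
af-ℕⁿ (suc n) = af-mono (af-∩ (af-comap af-ℕ V.head) (af-comap (af-ℕⁿ n) V.tail)
                              (λ y z → V.head y ℕ.≤? V.head z) (λ y z → Pointwise.decidable ℕ._≤?_ (V.tail y) (V.tail z)))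
                        λ { {_ ∷ _} {_ ∷ _} (p , q) → p ∷ q }

-- Equality on a finite set is almost full: embed Fin k into ℕᵏ by unit vectors.
unit : ∀ {k} → Fin k → Vec ℕ k
unit Fin.zero    = 1 ∷ V.replicate _ 0
unit (Fin.suc i) = 0 ∷ unit i

unit≰0 : ∀ {k} (i : Fin k) → ¬ Pointwise ℕ._≤_ (unit i) (V.replicate k 0)
unit≰0 Fin.zero    (() ∷ _)
unit≰0 (Fin.suc i) (_ ∷ p) = unit≰0 i p

unit-≤⇒≡ : ∀ {k} (i j : Fin k) → Pointwise ℕ._≤_ (unit i) (unit j) → i ≡ j
unit-≤⇒≡ Fin.zero    Fin.zero    _       = refl
unit-≤⇒≡ Fin.zero    (Fin.suc j) (() ∷ _)
unit-≤⇒≡ (Fin.suc i) Fin.zero    (_ ∷ p) = ⊥-elim (unit≰0 i p)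
unit-≤⇒≡ (Fin.suc i) (Fin.suc j) (_ ∷ p) = cong Fin.suc (unit-≤⇒≡ i j p)

af-Fin : ∀ k → AlmostFull (_≡_ {A = Fin k})
af-Fin k = af-mono (af-comap (af-ℕⁿ k) unit) (unit-≤⇒≡ _ _)

vec-ext : ∀ {A : Set} {n} {u v : Vec A n} → (∀ i → lookup u i ≡ lookup v i) → u ≡ v
vec-ext u≗v = Pointwise-≡⇒≡ (extensional⇒inductive (ext u≗v))

-- Valuations are built from blocks of n variables; block₀, block₁, block₂
-- address the entries of the first three blocks.
block₀ : ∀ {n m} → Fin n → Fin (n ℕ.+ m)
block₀ j = j ↑ˡ _

block₁ : ∀ {n m} → Fin n → Fin (n ℕ.+ (n ℕ.+ m))
block₁ {n} j = n ↑ʳ block₀ j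

block₂ : ∀ {n m} → Fin n → Fin (n ℕ.+ (n ℕ.+ (n ℕ.+ m)))
block₂ {n} j = n ↑ʳ block₁ j

select-block₀ : ∀ {n m} (u : Vec ℤ n) (w : Vec ℤ m) → select block₀ (u ++ w) ≡ u
select-block₀ u w = trans (VP.tabulate-cong (VP.lookup-++ˡ u w)) (VP.tabulate∘lookup u)

select-skip : ∀ {n m k} (p : Fin k → Fin m) (u : Vec ℤ n) w → select (λ j → n ↑ʳ p j) (u ++ w) ≡ select p w
select-skip p u w = VP.tabulate-cong (λ j → VP.lookup-++ʳ u w (p j))

select-block₁ : ∀ {n m} (u v : Vec ℤ n) (w : Vec ℤ m) → select block₁ (u ++ v ++ w) ≡ v
select-block₁ u v w = trans (select-skip block₀ u (v ++ w)) (select-block₀ v w)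

select-block₂ : ∀ {n m} (u v w : Vec ℤ n) (z : Vec ℤ m) → select block₂ (u ++ v ++ w ++ z) ≡ w
select-block₂ u v w z = trans (select-skip block₁ u (v ++ w ++ z)) (select-block₁ v w z)

lookup-select : ∀ {k m} (p : Fin k → Fin m) σ i → ⟦ varL (p i) ⟧L σ ≡ lookup (select p σ) i
lookup-select p σ i = trans (varL-sem (p i) σ) (sym (VP.lookup∘tabulate (lookup σ ∘ p) i))

rowL : ∀ {n} → AffineFun n → Fin n → Lin n
rowL f i = lin (lookup (AffineFun.b f) i) (V.map +_ (lookup (AffineFun.A f) i))

dotZ-pos : ∀ {n} (r x : Vec ℕ n) → dotZ (V.map +_ r) (V.map +_ x) ≡ + dot r x
dotZ-pos []      []      = refl
dotZ-pos (a ∷ r) (c ∷ x) rewrite dotZ-pos r x =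
  trans (cong (_+ + dot r x) (sym (ℤP.pos-* a c))) (sym (ℤP.pos-+ (a ℕ.* c) (dot r x)))

rowL-sem : ∀ {n} (f : AffineFun n) x i → ⟦ rowL f i ⟧L (V.map +_ x) ≡ lookup (applyℤ f x) i
rowL-sem f x i = begin
  bᵢ + dotZ (V.map +_ rowᵢ) (V.map +_ x) ≡⟨ cong (λ z → bᵢ + z) (dotZ-pos rowᵢ x) ⟩
  bᵢ + + dot rowᵢ x                      ≡⟨ ℤP.+-comm bᵢ (+ dot rowᵢ x) ⟩
  + dot rowᵢ x + bᵢ                      ≡⟨ VP.lookup-zipWith _ i (AffineFun.A f) (AffineFun.b f) ⟨
  lookup (applyℤ f x) i                  ∎
  where
  open ≡-Reasoning
  bᵢ : ℤ
  bᵢ = lookup (AffineFun.b f) i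
  rowᵢ : Vec ℕ _
  rowᵢ = lookup (AffineFun.A f) i

Stepℤ : ∀ {n} → AffineFun n → Vec ℤ n → Vec ℤ n → Set
Stepℤ f u v = ⟦ trF (AffineFun.dom f) ⟧Q u × (∀ i → ⟦ rowL f i ⟧L u ≡ lookup v i)

Belowℤ : ∀ {n} → Vec ℤ n → Vec ℤ n → Set
Belowℤ u v = ∀ i → lookup u i ≤ lookup v i

Stepℤ-sem : ∀ {n} (f : AffineFun n) {u v} x y → u ≡ V.map +_ x → v ≡ V.map +_ y → Stepℤ f u v ⇔ (x ↦[ f ] y)
Stepℤ-sem f x y refl refl = ⇔.sym (trF-sem (AffineFun.dom f) x) ×-⇔ mk⇔
  (λ rows≡y → vec-ext λ i → trans (sym (rowL-sem f x i)) (rows≡y i))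
  (λ fx≡y i → trans (rowL-sem f x i) (cong (λ v → lookup v i) fx≡y))

Belowℤ-sem : ∀ {n} {u v} (x y : Vec ℕ n) → u ≡ V.map +_ x → v ≡ V.map +_ y → Belowℤ u v ⇔ Pointwise ℕ._≤_ x y
Belowℤ-sem x y refl refl = mk⇔
  (λ x≤y → extensional⇒inductive (ext λ i →
     ℤP.drop‿+≤+ (subst₂ _≤_ (VP.lookup-map i +_ x) (VP.lookup-map i +_ y) (x≤y i))))
  (λ x≤y i → subst₂ _≤_ (sym (VP.lookup-map i +_ x)) (sym (VP.lookup-map i +_ y)) (ℤ.+≤+ (Pointwise.lookup x≤y i)))

def-Stepℤ : ∀ {n m} (f : AffineFun n) (pu pv : Fin n → Fin m) → Definable m (λ σ → Stepℤ f (select pu σ) (select pv σ))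
def-Stepℤ f pu pv = def-× (def-select pu (trF (AffineFun.dom f))) (def-∀Fin _ λ i →
  def-⇔ (λ σ → ≡⇒⇔ (cong₂ _≡_ (renL-sem pu (rowL f i) σ) (lookup-select pv σ i)))
        (def-≡ (renL pu (rowL f i)) (varL (pv i))))

def-Belowℤ : ∀ {n m} (pu pv : Fin n → Fin m) → Definable m (λ σ → Belowℤ (select pu σ) (select pv σ))
def-Belowℤ pu pv = def-∀Fin _ λ i →
  def-⇔ (λ σ → ≡⇒⇔ (cong₂ _≤_ (lookup-select pu σ i) (lookup-select pv σ i))) (def-≤ (varL (pu i)) (varL (pv i)))

strong⇒monotonic : ∀ T → IsStronglyMonotonic T → IsMonotonic T
strong⇒monotonic T sm s s′ s₁ s⟶s′ s⊑s₁ with sm s s′ s₁ s⟶s′ s⊑s₁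
... | s₁′ , s₁⟶s₁′ , s′⊑s₁′ = s₁′ , s₁⟶s₁′ ◅ ε , s′⊑s₁′

module _ {n : ℕ} (C : ACS n) where

  Transition : Set
  Transition = Fin (ACS.k C) × AffineFun n × Fin (ACS.k C)

  transitions : List Transition
  transitions = ACS.trans C

  Answers : Transition → Vec ℕ n → Vec ℕ n → Transition → Set
  Answers (q , _ , q′) x₁ y (p , f′ , p′) =
    q ≡ p × q′ ≡ p′ × ∃[ y₁ ] (x₁ ↦[ f′ ] y₁ × Pointwise ℕ._≤_ y y₁)

  MonotoneAt : Transition → Set
  MonotoneAt t@(_ , f , _) = ∀ x y x₁ → x ↦[ f ] y → Pointwise ℕ._≤_ x x₁ → Any (Answers t x₁ y) transitions

  strongly-monotonic⇔ : IsStronglyMonotonic (toOTS C) ⇔ All MonotoneAt transitions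
  strongly-monotonic⇔ = mk⇔ (λ sm → All.tabulate (λ t∈ → monotoneAt sm t∈)) strongly-monotonic
    where
    monotoneAt : IsStronglyMonotonic (toOTS C) → ∀ {t} → t ∈ transitions → MonotoneAt t
    monotoneAt sm {q , f , q′} t∈ x y x₁ x↦y x≤x₁ with sm (q , x) (q′ , y) (q , x₁) (f , t∈ , x↦y) (refl , x≤x₁)
    ... | (p′ , y₁) , (f′ , t′∈ , x₁↦y₁) , (q′≡p′ , y≤y₁) =
      lose t′∈ (refl , q′≡p′ , y₁ , x₁↦y₁ , y≤y₁)
    strongly-monotonic : All MonotoneAt transitions → IsStronglyMonotonic (toOTS C)
    strongly-monotonic all (q , x) (q′ , y) (.q , x₁) (f , t∈ , x↦y) (refl , x≤x₁)
      with find (All.lookup all t∈ x y x₁ x↦y x≤x₁)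
    ... | (.q , f′ , p′) , t′∈ , (refl , q′≡p′ , y₁ , x₁↦y₁ , y≤y₁) =
      (p′ , y₁) , (f′ , t′∈ , x₁↦y₁) , (q′≡p′ , y≤y₁)

  -- MonotoneAt t as a Presburger sentence, over the valuation (x₁, y, x)
  -- and, inside an answer, (y₁, x₁, y, x).
  private
    ctxSize : ℕ
    ctxSize = n ℕ.+ (n ℕ.+ (n ℕ.+ 0))

    Ctx : Set
    Ctx = Vec ℤ ctxSize

    ctx : Vec ℕ n → Vec ℕ n → Vec ℕ n → Ctx
    ctx x y x₁ = V.map +_ x₁ ++ V.map +_ y ++ V.map +_ x ++ []

  AnswerBody : AffineFun n → Vec ℤ (n ℕ.+ (n ℕ.+ (n ℕ.+ (n ℕ.+ 0)))) → Set
  AnswerBody f′ σ = Stepℤ f′ (select block₁ σ) (select block₀ σ)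
                  × Belowℤ {n} (select block₂ σ) (select block₀ σ)

  Answersℤ : Transition → Ctx → Transition → Set
  Answersℤ (q , _ , q′) σ (p , f′ , p′) =
    q ≡ p × q′ ≡ p′ × Σ (Vec ℕ n) λ y₁ → AnswerBody f′ (V.map +_ y₁ ++ σ)

  MonotoneAtℤ : Transition → Ctx → Set
  MonotoneAtℤ t@(_ , f , _) σ = Stepℤ f (select block₂ σ) (select block₁ σ)
                              → Belowℤ {n} (select block₂ σ) (select block₀ σ)
                              → Any (Answersℤ t σ) transitions

  def-MonotoneAtℤ : ∀ t → Definable ctxSize (MonotoneAtℤ t)
  def-MonotoneAtℤ t@(q , f , q′) =
    def-→ (def-Stepℤ f block₂ block₁) (def-→ (def-Belowℤ {n} block₂ block₀) (def-Any transitions def-Answersℤ))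
    where
    def-Answersℤ : ∀ t′ → Definable ctxSize (λ σ → Answersℤ t σ t′)
    def-Answersℤ (p , f′ , p′) =
      def-× (def-const (q Fin.≟ p)) (def-× (def-const (q′ Fin.≟ p′))
        (def-∃ℕᵏ n (def-× (def-Stepℤ f′ block₁ block₀) (def-Belowℤ {n} block₂ block₀))))

  MonotoneAtℤ-sem : ∀ q f q′ x y x₁ → MonotoneAtℤ (q , f , q′) (ctx x y x₁) ⇔
                    (x ↦[ f ] y → Pointwise ℕ._≤_ x x₁ → Any (Answers (q , f , q′) x₁ y) transitions)
  MonotoneAtℤ-sem q f q′ x y x₁ =
    →-cong-⇔ (Stepℤ-sem f x y (select-block₂ ⟨x₁⟩ ⟨y⟩ ⟨x⟩ []) (select-block₁ ⟨x₁⟩ ⟨y⟩ (⟨x⟩ ++ [])))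
      (→-cong-⇔ (Belowℤ-sem x x₁ (select-block₂ ⟨x₁⟩ ⟨y⟩ ⟨x⟩ [])
                                 (select-block₀ ⟨x₁⟩ (⟨y⟩ ++ ⟨x⟩ ++ [])))
        (Any-⇔ transitions answers-sem))
    where
    ⟨x⟩ ⟨y⟩ ⟨x₁⟩ : Vec ℤ n
    ⟨x⟩ = V.map +_ x
    ⟨y⟩ = V.map +_ y
    ⟨x₁⟩ = V.map +_ x₁
    answers-sem : ∀ t′ → Answersℤ (q , f , q′) (ctx x y x₁) t′ ⇔ Answers (q , f , q′) x₁ y t′
    answers-sem (p , f′ , p′) = ⇔.refl ×-⇔ ⇔.refl ×-⇔ Σ-⇔ λ y₁ →
      Stepℤ-sem f′ x₁ y₁ (select-block₁ (V.map +_ y₁) ⟨x₁⟩ (⟨y⟩ ++ ⟨x⟩ ++ []))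
                         (select-block₀ (V.map +_ y₁) (ctx x y x₁))
      ×-⇔ Belowℤ-sem y y₁ (select-block₂ (V.map +_ y₁) ⟨x₁⟩ ⟨y⟩ (⟨x⟩ ++ []))
                         (select-block₀ (V.map +_ y₁) (ctx x y x₁))

  MonotoneAt? : ∀ t → Dec (MonotoneAt t)
  MonotoneAt? t@(q , f , q′) = Dec.map (Π-⇔ λ x → Π-⇔ λ y → Π-⇔ λ x₁ → MonotoneAtℤ-sem q f q′ x y x₁)
    (definable⇒dec (def-∀ℕᵏ n (def-∀ℕᵏ n (def-∀ℕᵏ n (def-MonotoneAtℤ t)))) [])

  strongly-monotonic? : Dec (IsStronglyMonotonic (toOTS C))
  strongly-monotonic? = Dec.map (⇔.sym strongly-monotonic⇔) (All.all? MonotoneAt? transitions)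

  ≤S-isPartialOrder : IsPartialOrder _≡_ (_≤S_ {C = C})
  ≤S-isPartialOrder = record
    { isPreorder = record
      { isEquivalence = isEquivalence
      ; reflexive     = λ { refl → refl , Pointwise.refl ℕP.≤-refl }
      ; trans         = λ { (refl , x≤y) (refl , y≤z) → refl , Pointwise.trans ℕP.≤-trans x≤y y≤z }
      }
    ; antisym = λ { (refl , x≤y) (_ , y≤x) → cong (_ ,_) (≤ⁿ-antisym x≤y y≤x) }
    }
    where
    ≤ⁿ-antisym : ∀ {m} {x y : Vec ℕ m} → Pointwise ℕ._≤_ x y → Pointwise ℕ._≤_ y x → x ≡ y
    ≤ⁿ-antisym []          []          = refl
    ≤ⁿ-antisym (a≤b ∷ x≤y) (b≤a ∷ y≤x) = cong₂ _∷_ (ℕP.≤-antisym a≤b b≤a) (≤ⁿ-antisym x≤y y≤x)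

  ≤S-almostFull : AlmostFull (_≤S_ {C = C})
  ≤S-almostFull = af-∩ (af-comap (af-Fin (ACS.k C)) proj₁) (af-comap (af-ℕⁿ n) proj₂)
                       (λ s t → proj₁ s Fin.≟ proj₁ t) (λ s t → Pointwise.decidable ℕ._≤?_ (proj₂ s) (proj₂ t))

  ≤S-wpo : IsWellPartialOrder (_≤S_ {C = C})
  ≤S-wpo = ≤S-isPartialOrder , af-good ≤S-almostFull

  strongly-monotonic-WSTS⇔ : IsStronglyMonotonicWSTS (toOTS C) ⇔ IsStronglyMonotonic (toOTS C)
  strongly-monotonic-WSTS⇔ = mk⇔ proj₂ λ sm → (≤S-wpo , strong⇒monotonic (toOTS C) sm) , sm

proposition6p4 : ∀ {n : ℕ} (C : ACS n) → Dec (IsStronglyMonotonicWSTS (toOTS C))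
proposition6p4 C = Dec.map (⇔.sym (strongly-monotonic-WSTS⇔ C)) (strongly-monotonic? C)
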